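{- For every nonnegative integer $\ell$, every nonnegative integer $n$ and every complex number $x$, $${}_3F_2\left[\begin{matrix} 3x,\ 1-\ell-3x,\ -n\\ \tfrac12,\ -1-3n\end{matrix}\middle|\frac34\right]=\left[\begin{matrix} 3x\\ 6x\end{matrix}\right]_\ell\sum_{i=0}^{\ell}(-1)^i\,\frac{6x+2i-1}{6x-1}\left[\begin{matrix} -\ell,\ 6x-1\\ 1,\ 6x+\ell\end{matrix}\right]_i\left\{(3x+i)\left[\begin{matrix} \frac{3+i}{3}+x,\ \frac{3-i}{3}-x\\ \frac23,\ \frac43\end{matrix}\right]_n-(3x+i-1)\left[\begin{matrix} \frac{2+i}{3}+x,\ \frac{4-i}{3}-x\\ \frac23,\ \frac43\end{matrix}\right]_n\right\}.$$
   Context: For a complex number $a$ and a nonnegative integer $m$, $(a)_m=a(a+1)\cdots(a+m-1)$ with $(a)_0=1$. The bracket notation means $\left[\begin{matrix} a_1,\dots,a_r\\ b_1,\dots,b_s\end{matrix}\right]_m=\frac{(a_1)_m\cdots(a_r)_m}{(b_1)_m\cdots(b_s)_m}$. For a nonnegative integer $n$, ${}_3F_2\left[\begin{matrix} a,\ b,\ -n\\ d,\ e\end{matrix}\middle|z\right]=\sum_{k=0}^{n}\frac{(a)_k(b)_k(-n)_k}{k!\,(d)_k(e)_k}z^k$. The identity is understood for values of $x$ for which no denominator vanishes. -}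

module Defs where

open import Level using (Level; _⊔_) renaming (suc to lsuc)
open import Algebra.Bundles using (CommutativeRing)
open import Data.Nat using (ℕ; zero; suc)
open import Relation.Nullary using (¬_)

embed : ∀ {c ℓ} (R : CommutativeRing c ℓ) → ℕ → CommutativeRing.Carrier R
embed R zero    = CommutativeRing.0# R
embed R (suc n) = CommutativeRing._+_ R (CommutativeRing.1# R) (embed R n)

-- A field of characteristic zero (stdlib has no Field bundle).
-- The inverse is a total operation, only constrained on nonzero elements.
record Field0 (c ℓ : Level) : Set (lsuc (c ⊔ ℓ)) where
  field
    cring : CommutativeRing c ℓ
  open CommutativeRing cring public using (Carrier; _≈_; _+_; _*_; -_; _-_; 0#; 1#)
  field
    _⁻¹        : Carrier → Carrier
    ⁻¹-inverse : ∀ a → ¬ (a ≈ 0#) → a * (a ⁻¹) ≈ 1#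
    char0      : ∀ n → ¬ (embed cring (suc n) ≈ 0#)

  infix 8 _⁻¹

  ι : ℕ → Carrier
  ι = embed cring

  _÷_ : Carrier → Carrier → Carrier
  a ÷ b = a * (b ⁻¹)
  infixl 7 _÷_

  pow : Carrier → ℕ → Carrier
  pow a zero    = 1#
  pow a (suc m) = pow a m * a

  sgn : ℕ → Carrier
  sgn m = pow (- 1#) m

  poch : Carrier → ℕ → Carrier
  poch a zero    = 1#
  poch a (suc m) = poch a m * (a + ι m)

  fact : ℕ → Carrier
  fact m = poch 1# m

  sumTo : ℕ → (ℕ → Carrier) → Carrier
  sumTo zero    f = f zero
  sumTo (suc m) f = sumTo m f + f (suc m)

  br2/2 : Carrier → Carrier → Carrier → Carrier → ℕ → Carrier
  br2/2 a1 a2 b1 b2 m = (poch a1 m * poch a2 m) ÷ (poch b1 m * poch b2 m)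

  br1/1 : Carrier → Carrier → ℕ → Carrier
  br1/1 a b m = poch a m ÷ poch b m

  F32 : Carrier → Carrier → ℕ → Carrier → Carrier → Carrier → Carrier
  F32 a b n d e z =
    sumTo n (λ k → ((poch a k * poch b k * poch (- ι n) k)
                     ÷ (fact k * poch d k * poch e k)) * pow z k)

-- Write Φ(n, l, a) = ₃F₂[a, 1-l-a, -n; 1/2, -1-3n | 3/4], so that the left-hand side is Φ(n, l, 3x).
--
-- The contiguous relation (2a+l) Φ(n, l+1, a) = a Φ(n, l, a+1) + (l+a) Φ(n, l, a), checked termwise,
-- lets one induct on l and expand Φ(n, l, a) = Σᵢ c(a, l, i) Φ(n, 0, a+i); the coefficients c(a, l, i)
-- are exactly the factors [a; 2a]_l (-1)ⁱ (2a+2i-1)/(2a-1) [-l, 2a-1; 1, 2a+l]ᵢ of the statement, because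
-- these satisfy the same three-term recurrence in l.
--
-- For l = 0 the series is summed in closed form. Let ω₁(k, s) = s ∏_{1≤j≤k} (s²-j²) and
-- ω₃(n, s) = s ∏_{1≤j≤n} (s²-9j²). Then ω₁(k, s) - ω₁(k, s-1) = (-1)ᵏ (2k+1) (s)ₖ (1-s)ₖ, and the
-- coefficient of ω₁(k, ·) in ω₃(n, ·) is, up to a factor independent of k, (-1)ᵏ/(2k+1) times the k-th
-- term of the series: passing from ω₃(n, ·) to ω₃(n+1, ·) both sides obey the same first-order
-- recurrence in k. Hence Φ(n, 0, s) is a constant multiple of ω₃(n, s) - ω₃(n, s-1), and splitting the
-- products in ω₃ into step-3 Pochhammer symbols gives the two brackets of the statement.

module Submission where

open import Defs
open import Data.Nat using (ℕ; _<_)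
open import Relation.Nullary using (¬_; yes; no)
open import Data.Nat as N using (zero; suc; _≤_; z≤n; s≤s)
import Data.Nat.Properties as NP
open import Data.Integer as Z using (ℤ; +_; -[1+_])
import Data.Integer.Properties as ZP
open import Data.Sign as S using (Sign)
open import Data.Maybe using (Maybe; just; nothing)
open import Data.Product using (_×_; _,_; proj₁; proj₂)
open import Relation.Binary.PropositionalEquality as P using (_≡_)
open import Algebra.Bundles using (CommutativeRing)
import Algebra.Solver.Ring.AlmostCommutativeRing as ACR
import Algebra.Solver.Ring as RingSolver
import Relation.Binary.Reasoning.Setoid as SetoidReasoning

module FieldSolver {c ℓ} (F : Field0 c ℓ) where
  open Field0 F public
  open CommutativeRing cring public
    using ( setoid; refl; sym; trans; +-cong; *-cong; -‿cong; +-comm; *-comm; +-assoc; *-assoc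
          ; +-identityˡ; +-identityʳ; *-identityˡ; *-identityʳ; zeroˡ; zeroʳ; distribʳ; distribˡ; -‿inverseʳ)
  open SetoidReasoning setoid public
  open import Algebra.Properties.Ring (CommutativeRing.ring cring) public using (-1*x≈-x)
  open import Algebra.Properties.AbelianGroup (CommutativeRing.+-abelianGroup cring) public using (⁻¹-∙-comm)
  open import Algebra.Properties.Group (CommutativeRing.+-group cring) public
    using () renaming (⁻¹-involutive to -‿involutive; ε⁻¹≈ε to -0#≈0#)
  open import Algebra.Properties.CommutativeSemigroup (CommutativeRing.*-commutativeSemigroup cring) public
    using (interchange)

  -‿distrib-+ : ∀ x y → - (x + y) ≈ - x + - y
  -‿distrib-+ x y = sym (⁻¹-∙-comm x y)

  ι-+ : ∀ m n → ι (m N.+ n) ≈ ι m + ι n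
  ι-+ zero n = sym (+-identityˡ _)
  ι-+ (suc m) n = trans (+-cong refl (ι-+ m n)) (sym (+-assoc _ _ _))

  ι-* : ∀ m n → ι (m N.* n) ≈ ι m * ι n
  ι-* zero n = sym (zeroˡ _)
  ι-* (suc m) n = begin
    ι (n N.+ m N.* n)     ≈⟨ ι-+ n (m N.* n) ⟩
    ι n + ι (m N.* n)     ≈⟨ +-cong (sym (*-identityˡ _)) (ι-* m n) ⟩
    1# * ι n + ι m * ι n  ≈⟨ sym (distribʳ _ _ _) ⟩
    (1# + ι m) * ι n      ∎

  ιℤ : ℤ → Carrier
  ιℤ (+ n) = ι n
  ιℤ -[1+ n ] = - ι (suc n)

  ιℤ-⊖ : ∀ m n → ιℤ (m Z.⊖ n) ≈ ι m - ι n
  ιℤ-⊖ zero zero = sym (-‿inverseʳ _)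
  ιℤ-⊖ zero (suc n) = sym (+-identityˡ _)
  ιℤ-⊖ (suc m) zero = sym (trans (+-cong refl -0#≈0#) (+-identityʳ _))
  ιℤ-⊖ (suc m) (suc n) = begin
    ιℤ (suc m Z.⊖ suc n)              ≡⟨ P.cong ιℤ (ZP.[1+m]⊖[1+n]≡m⊖n m n) ⟩
    ιℤ (m Z.⊖ n)                      ≈⟨ ιℤ-⊖ m n ⟩
    ι m - ι n                         ≈⟨ sym (+-identityˡ _) ⟩
    0# + (ι m - ι n)                  ≈⟨ +-cong (sym (-‿inverseʳ 1#)) refl ⟩
    (1# - 1#) + (ι m - ι n)           ≈⟨ interchange⁺ 1# (- 1#) (ι m) (- ι n) ⟩
    (1# + ι m) + (- 1# + - ι n)       ≈⟨ +-cong refl (sym (-‿distrib-+ _ _)) ⟩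
    (1# + ι m) - (1# + ι n)           ∎
    where
    open import Algebra.Properties.CommutativeSemigroup (CommutativeRing.+-commutativeSemigroup cring)
      using () renaming (interchange to interchange⁺)

  ιℤ-neg : ∀ i → ιℤ (Z.- i) ≈ - ιℤ i
  ιℤ-neg (+ zero) = sym -0#≈0#
  ιℤ-neg (+ suc n) = refl
  ιℤ-neg -[1+ n ] = sym (-‿involutive _)

  ιℤ-+ : ∀ i j → ιℤ (i Z.+ j) ≈ ιℤ i + ιℤ j
  ιℤ-+ -[1+ m ] -[1+ n ] = begin
    - ι (suc (suc (m N.+ n)))  ≡⟨ P.cong (λ t → - ι (suc t)) (P.sym (NP.+-suc m n)) ⟩
    - ι (suc m N.+ suc n)      ≈⟨ -‿cong (ι-+ (suc m) (suc n)) ⟩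
    - (ι (suc m) + ι (suc n))  ≈⟨ -‿distrib-+ _ _ ⟩
    - ι (suc m) + - ι (suc n)  ∎
  ιℤ-+ -[1+ m ] (+ n) = trans (ιℤ-⊖ n (suc m)) (+-comm _ _)
  ιℤ-+ (+ m) -[1+ n ] = ιℤ-⊖ m (suc n)
  ιℤ-+ (+ m) (+ n) = ι-+ m n

  signValue : Sign → Carrier
  signValue S.+ = 1#
  signValue S.- = - 1#

  signValue-* : ∀ s t → signValue (s S.* t) ≈ signValue s * signValue t
  signValue-* S.+ S.+ = sym (*-identityˡ _)
  signValue-* S.+ S.- = sym (*-identityˡ _)
  signValue-* S.- S.+ = sym (*-identityʳ _)
  signValue-* S.- S.- = sym (trans (-1*x≈-x _) (-‿involutive _))

  ιℤ-◃ : ∀ s n → ιℤ (s Z.◃ n) ≈ signValue s * ι n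
  ιℤ-◃ s zero = sym (zeroʳ _)
  ιℤ-◃ S.+ (suc n) = sym (*-identityˡ _)
  ιℤ-◃ S.- (suc n) = sym (-1*x≈-x _)

  ιℤ-sign-abs : ∀ i → ιℤ i ≈ signValue (Z.sign i) * ι Z.∣ i ∣
  ιℤ-sign-abs (+ n) = sym (*-identityˡ _)
  ιℤ-sign-abs -[1+ n ] = sym (-1*x≈-x _)

  ιℤ-* : ∀ i j → ιℤ (i Z.* j) ≈ ιℤ i * ιℤ j
  ιℤ-* i j = begin
    ιℤ (i Z.* j)
      ≈⟨ ιℤ-◃ (Z.sign i S.* Z.sign j) (Z.∣ i ∣ N.* Z.∣ j ∣) ⟩
    signValue (Z.sign i S.* Z.sign j) * ι (Z.∣ i ∣ N.* Z.∣ j ∣)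
      ≈⟨ *-cong (signValue-* (Z.sign i) (Z.sign j)) (ι-* Z.∣ i ∣ Z.∣ j ∣) ⟩
    (signValue (Z.sign i) * signValue (Z.sign j)) * (ι Z.∣ i ∣ * ι Z.∣ j ∣)
      ≈⟨ interchange _ _ _ _ ⟩
    (signValue (Z.sign i) * ι Z.∣ i ∣) * (signValue (Z.sign j) * ι Z.∣ j ∣)
      ≈⟨ sym (*-cong (ιℤ-sign-abs i) (ιℤ-sign-abs j)) ⟩
    ιℤ i * ιℤ j ∎

  -- The solver's coefficient semantics agrees with ιℤ, but sends 0, 1 and -1 definitionally to
  -- 0#, 1# and - 1#, so that goals containing those constants match their solver expressions.
  ⟦_⟧ℕ : ℕ → Carrier
  ⟦ zero ⟧ℕ = 0#
  ⟦ suc zero ⟧ℕ = 1#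
  ⟦ suc (suc n) ⟧ℕ = ι (suc (suc n))

  ⟦_⟧ℤ : ℤ → Carrier
  ⟦ + n ⟧ℤ = ⟦ n ⟧ℕ
  ⟦ -[1+ n ] ⟧ℤ = - ⟦ suc n ⟧ℕ

  ⟦⟧ℕ≈ι : ∀ n → ⟦ n ⟧ℕ ≈ ι n
  ⟦⟧ℕ≈ι zero = refl
  ⟦⟧ℕ≈ι (suc zero) = sym (+-identityʳ _)
  ⟦⟧ℕ≈ι (suc (suc n)) = refl

  ⟦⟧ℤ≈ιℤ : ∀ i → ⟦ i ⟧ℤ ≈ ιℤ i
  ⟦⟧ℤ≈ιℤ (+ n) = ⟦⟧ℕ≈ι n
  ⟦⟧ℤ≈ιℤ -[1+ n ] = -‿cong (⟦⟧ℕ≈ι (suc n))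

  almostCommRing : ACR.AlmostCommutativeRing c ℓ
  almostCommRing = ACR.fromCommutativeRing cring

  ℤ⟶field : Z.+-*-rawRing ACR.-Raw-AlmostCommutative⟶ almostCommRing
  ℤ⟶field = record
    { ⟦_⟧ = ⟦_⟧ℤ
    ; +-homo = λ i j → trans (⟦⟧ℤ≈ιℤ (i Z.+ j)) (trans (ιℤ-+ i j) (sym (+-cong (⟦⟧ℤ≈ιℤ i) (⟦⟧ℤ≈ιℤ j))))
    ; *-homo = λ i j → trans (⟦⟧ℤ≈ιℤ (i Z.* j)) (trans (ιℤ-* i j) (sym (*-cong (⟦⟧ℤ≈ιℤ i) (⟦⟧ℤ≈ιℤ j))))
    ; -‿homo = λ i → trans (⟦⟧ℤ≈ιℤ (Z.- i)) (trans (ιℤ-neg i) (sym (-‿cong (⟦⟧ℤ≈ιℤ i))))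
    ; 0-homo = refl
    ; 1-homo = refl
    }

  ⟦⟧ℤ-≟ : ∀ i j → Maybe (⟦ i ⟧ℤ ≈ ⟦ j ⟧ℤ)
  ⟦⟧ℤ-≟ i j with i Z.≟ j
  ... | yes P.refl = just refl
  ... | no _ = nothing

  open RingSolver Z.+-*-rawRing almostCommRing ℤ⟶field ⟦⟧ℤ-≟ public
    using (solve; _:=_; _:+_; _:*_; _:-_; :-_; con; Polynomial)

module FieldLemmas {c ℓ} (F : Field0 c ℓ) where
  open FieldSolver F public

  NonZero : Carrier → Set ℓ
  NonZero a = ¬ (a ≈ 0#)

  NonZero-resp : ∀ {a b} → a ≈ b → NonZero a → NonZero b
  NonZero-resp e h z = h (trans e z)

  1-nonZero : NonZero 1#
  1-nonZero = NonZero-resp (+-identityʳ 1#) (char0 0)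

  ⁻¹-inverseʳ : ∀ {a} → NonZero a → a * a ⁻¹ ≈ 1#
  ⁻¹-inverseʳ {a} = ⁻¹-inverse a

  ⁻¹-inverseˡ : ∀ {a} → NonZero a → a ⁻¹ * a ≈ 1#
  ⁻¹-inverseˡ h = trans (*-comm _ _) (⁻¹-inverseʳ h)

  *-cancelʳ : ∀ {d x y} → NonZero d → x * d ≈ y * d → x ≈ y
  *-cancelʳ {d} {x} {y} h e = begin
    x               ≈⟨ sym (*-identityʳ x) ⟩
    x * 1#          ≈⟨ *-cong refl (sym (⁻¹-inverseʳ h)) ⟩
    x * (d * d ⁻¹)  ≈⟨ sym (*-assoc _ _ _) ⟩
    (x * d) * d ⁻¹  ≈⟨ *-cong e refl ⟩
    (y * d) * d ⁻¹  ≈⟨ *-assoc _ _ _ ⟩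
    y * (d * d ⁻¹)  ≈⟨ *-cong refl (⁻¹-inverseʳ h) ⟩
    y * 1#          ≈⟨ *-identityʳ y ⟩
    y               ∎

  *-nonZero : ∀ {a b} → NonZero a → NonZero b → NonZero (a * b)
  *-nonZero {a} {b} ha hb ab≈0 = hb (*-cancelʳ ha (begin
    b * a   ≈⟨ *-comm b a ⟩
    a * b   ≈⟨ ab≈0 ⟩
    0#      ≈⟨ sym (zeroˡ a) ⟩
    0# * a  ∎))

  -‿nonZero : ∀ {a} → NonZero a → NonZero (- a)
  -‿nonZero {a} h e = h (begin
    a        ≈⟨ sym (-‿involutive a) ⟩
    - (- a)  ≈⟨ -‿cong e ⟩
    - 0#     ≈⟨ -0#≈0# ⟩
    0#       ∎)

  ÷-*-cancel : ∀ {a b} → NonZero b → (a ÷ b) * b ≈ a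
  ÷-*-cancel {a} {b} h = begin
    (a * b ⁻¹) * b  ≈⟨ *-assoc _ _ _ ⟩
    a * (b ⁻¹ * b)  ≈⟨ *-cong refl (⁻¹-inverseˡ h) ⟩
    a * 1#          ≈⟨ *-identityʳ a ⟩
    a               ∎

  ⁻¹-unique : ∀ {a b} → NonZero a → a * b ≈ 1# → b ≈ a ⁻¹
  ⁻¹-unique h e = *-cancelʳ h (trans (*-comm _ _) (trans e (sym (⁻¹-inverseˡ h))))

  ⁻¹-distrib-* : ∀ {a b} → NonZero a → NonZero b → (a * b) ⁻¹ ≈ a ⁻¹ * b ⁻¹
  ⁻¹-distrib-* {a} {b} ha hb = sym (⁻¹-unique (*-nonZero ha hb) (begin
    (a * b) * (a ⁻¹ * b ⁻¹)  ≈⟨ interchange _ _ _ _ ⟩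
    (a * a ⁻¹) * (b * b ⁻¹)  ≈⟨ *-cong (⁻¹-inverseʳ ha) (⁻¹-inverseʳ hb) ⟩
    1# * 1#                  ≈⟨ *-identityˡ 1# ⟩
    1#                       ∎))

  ⁻¹-cong : ∀ {a b} → NonZero a → a ≈ b → a ⁻¹ ≈ b ⁻¹
  ⁻¹-cong h e = ⁻¹-unique (NonZero-resp e h) (trans (*-cong (sym e) refl) (⁻¹-inverseʳ h))

  1⁻¹≈1 : 1# ⁻¹ ≈ 1#
  1⁻¹≈1 = sym (⁻¹-unique 1-nonZero (*-identityˡ 1#))

  ÷-cong : ∀ {a a' b b'} → NonZero b → a ≈ a' → b ≈ b' → a ÷ b ≈ a' ÷ b'
  ÷-cong h ea eb = *-cong ea (⁻¹-cong h eb)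

  ÷-scale : ∀ {x y e} → NonZero y → NonZero e → x ÷ y ≈ (x * e) ÷ (y * e)
  ÷-scale {x} {y} {e} hy he = begin
    x * y ⁻¹                ≈⟨ sym (*-identityʳ _) ⟩
    (x * y ⁻¹) * 1#         ≈⟨ *-cong refl (sym (⁻¹-inverseʳ he)) ⟩
    (x * y ⁻¹) * (e * e ⁻¹) ≈⟨ interchange x (y ⁻¹) e (e ⁻¹) ⟩
    (x * e) * (y ⁻¹ * e ⁻¹) ≈⟨ *-cong refl (sym (⁻¹-distrib-* hy he)) ⟩
    (x * e) * (y * e) ⁻¹    ∎

  ÷-product₃ : ∀ {x₁ y₁ s x₂ y₂ x₃ y₃} → NonZero y₁ → NonZero y₂ → NonZero y₃ →
    (x₁ ÷ y₁) * (s * (x₂ ÷ y₂) * (x₃ ÷ y₃)) ≈ (x₁ * (s * x₂) * x₃) ÷ (y₁ * y₂ * y₃)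
  ÷-product₃ {x₁} {y₁} {s} {x₂} {y₂} {x₃} {y₃} h₁ h₂ h₃ = begin
    (x₁ * y₁ ⁻¹) * (s * (x₂ * y₂ ⁻¹) * (x₃ * y₃ ⁻¹))
      ≈⟨ solve 7 (λ x₁ i₁ s x₂ i₂ x₃ i₃ → (x₁ :* i₁) :* (s :* (x₂ :* i₂) :* (x₃ :* i₃))
                   := (x₁ :* (s :* x₂) :* x₃) :* (i₁ :* i₂ :* i₃)) refl x₁ (y₁ ⁻¹) s x₂ (y₂ ⁻¹) x₃ (y₃ ⁻¹) ⟩
    (x₁ * (s * x₂) * x₃) * (y₁ ⁻¹ * y₂ ⁻¹ * y₃ ⁻¹)
      ≈⟨ *-cong refl (trans (*-cong (sym (⁻¹-distrib-* h₁ h₂)) refl) (sym (⁻¹-distrib-* (*-nonZero h₁ h₂) h₃))) ⟩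
    (x₁ * (s * x₂) * x₃) * (y₁ * y₂ * y₃) ⁻¹ ∎

  ÷-cross : ∀ {x y m x' y' m'} → NonZero y → NonZero y' →
    x * m * y' ≈ x' * m' * y → (x ÷ y) * m ≈ (x' ÷ y') * m'
  ÷-cross {x} {y} {m} {x'} {y'} {m'} hy hy' e = *-cancelʳ (*-nonZero hy hy') (begin
    (x * y ⁻¹) * m * (y * y')
      ≈⟨ solve 5 (λ x yi m y y' → (x :* yi) :* m :* (y :* y') := (x :* m :* y') :* (yi :* y)) refl x (y ⁻¹) m y y' ⟩
    (x * m * y') * (y ⁻¹ * y)   ≈⟨ *-cong e (⁻¹-inverseˡ hy) ⟩
    (x' * m' * y) * 1#          ≈⟨ *-cong refl (sym (⁻¹-inverseˡ hy')) ⟩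
    (x' * m' * y) * (y' ⁻¹ * y')
      ≈⟨ solve 5 (λ x m y yi y' → (x :* m :* y) :* (yi :* y') := (x :* yi) :* m :* (y :* y')) refl x' m' y (y' ⁻¹) y' ⟩
    (x' * y' ⁻¹) * m' * (y * y') ∎)

  -ι+ι-nonZero : ∀ {m j} → j < m → NonZero (- ι m + ι j)
  -ι+ι-nonZero {m} {j} j<m = NonZero-resp -ι[1+r]≈-ιm+ιj (-‿nonZero (char0 r))
    where
    r = m N.∸ suc j
    -ι[1+r]≈-ιm+ιj : - ι (suc r) ≈ - ι m + ι j
    -ι[1+r]≈-ιm+ιj = begin
      - ι (suc r)                ≈⟨ solve 2 (λ x y → :- y := (:- (x :+ y)) :+ x) refl (ι j) (ι (suc r)) ⟩
      - (ι j + ι (suc r)) + ι j  ≈⟨ +-cong (-‿cong (sym (ι-+ j (suc r)))) refl ⟩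
      - ι (j N.+ suc r) + ι j    ≡⟨ P.cong (λ t → - ι t + ι j) (P.trans (NP.+-suc j r) (NP.m+[n∸m]≡n j<m)) ⟩
      - ι m + ι j                ∎

module SumLemmas {c ℓ} (F : Field0 c ℓ) where
  open FieldLemmas F public

  sumTo-cong : ∀ n {f g : ℕ → Carrier} → (∀ k → k ≤ n → f k ≈ g k) → sumTo n f ≈ sumTo n g
  sumTo-cong zero h = h 0 z≤n
  sumTo-cong (suc n) h = +-cong (sumTo-cong n (λ k k≤n → h k (NP.m≤n⇒m≤1+n k≤n))) (h (suc n) NP.≤-refl)

  sumTo-+ : ∀ n (f g : ℕ → Carrier) → sumTo n (λ k → f k + g k) ≈ sumTo n f + sumTo n g
  sumTo-+ zero f g = refl
  sumTo-+ (suc n) f g = trans (+-cong (sumTo-+ n f g) refl) (interchange⁺ _ _ _ _)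
    where
    open import Algebra.Properties.CommutativeSemigroup (CommutativeRing.+-commutativeSemigroup cring)
      using () renaming (interchange to interchange⁺)

  *-distribˡ-sumTo : ∀ n (x : Carrier) (f : ℕ → Carrier) → x * sumTo n f ≈ sumTo n (λ k → x * f k)
  *-distribˡ-sumTo zero x f = refl
  *-distribˡ-sumTo (suc n) x f = trans (distribˡ _ _ _) (+-cong (*-distribˡ-sumTo n x f) refl)

  sumTo-factorˡ : ∀ n x (f g : ℕ → Carrier) → sumTo n (λ k → (x * f k) * g k) ≈ x * sumTo n (λ k → f k * g k)
  sumTo-factorˡ n x f g = trans (sumTo-cong n (λ k _ → *-assoc _ _ _)) (sym (*-distribˡ-sumTo n x _))

  sumTo-neg : ∀ n (f : ℕ → Carrier) → sumTo n (λ k → - f k) ≈ - sumTo n f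
  sumTo-neg zero f = refl
  sumTo-neg (suc n) f = trans (+-cong (sumTo-neg n f) refl) (sym (-‿distrib-+ _ _))

  sumTo-minus : ∀ n (f g : ℕ → Carrier) → sumTo n (λ k → f k - g k) ≈ sumTo n f - sumTo n g
  sumTo-minus n f g = trans (sumTo-+ n f (λ k → - g k)) (+-cong refl (sumTo-neg n g))

  sumTo-shift : ∀ n (f : ℕ → Carrier) → sumTo (suc n) f ≈ f 0 + sumTo n (λ k → f (suc k))
  sumTo-shift zero f = refl
  sumTo-shift (suc n) f = trans (+-cong (sumTo-shift n f) refl) (+-assoc _ _ _)

  sumTo-+-shifted : ∀ n (x y z : ℕ → Carrier) → y (suc n) ≈ 0# → y 0 ≈ z 0 →
    (∀ k → k ≤ n → x k + y (suc k) ≈ z (suc k)) → sumTo n x + sumTo n y ≈ sumTo (suc n) z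
  sumTo-+-shifted n x y z y-top≈0 y0≈z0 x+y≈z = begin
    sumTo n x + sumTo n y                              ≈⟨ +-cong refl (sym (+-identityʳ _)) ⟩
    sumTo n x + (sumTo n y + 0#)                       ≈⟨ +-cong refl (+-cong refl (sym y-top≈0)) ⟩
    sumTo n x + sumTo (suc n) y                        ≈⟨ +-cong refl (sumTo-shift n y) ⟩
    sumTo n x + (y 0 + sumTo n (λ k → y (suc k)))      ≈⟨ solve 3 (λ a b c → a :+ (b :+ c) := b :+ (a :+ c)) refl _ _ _ ⟩
    y 0 + (sumTo n x + sumTo n (λ k → y (suc k)))      ≈⟨ +-cong refl (sym (sumTo-+ n x (λ k → y (suc k)))) ⟩
    y 0 + sumTo n (λ k → x k + y (suc k))              ≈⟨ +-cong y0≈z0 (sumTo-cong n x+y≈z) ⟩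
    z 0 + sumTo n (λ k → z (suc k))                    ≈⟨ sym (sumTo-shift n z) ⟩
    sumTo (suc n) z                                    ∎

  poch-cong : ∀ k {a b} → a ≈ b → poch a k ≈ poch b k
  poch-cong zero e = refl
  poch-cong (suc k) e = *-cong (poch-cong k e) (+-cong e refl)

  poch-suc-shift : ∀ k {a b} → b ≈ a + 1# → poch a (suc k) ≈ a * poch b k
  poch-suc-shift zero {a} e = trans (*-identityˡ _) (trans (+-identityʳ a) (sym (*-identityʳ a)))
  poch-suc-shift (suc k) {a} {b} e = begin
    poch a (suc k) * (a + ι (suc k))   ≈⟨ *-cong (poch-suc-shift k e) refl ⟩
    (a * poch b k) * (a + (1# + ι k))  ≈⟨ *-assoc _ _ _ ⟩
    a * (poch b k * (a + (1# + ι k)))  ≈⟨ *-cong refl (*-cong refl (trans (sym (+-assoc _ _ _)) (+-cong (sym e) refl))) ⟩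
    a * (poch b k * (b + ι k))         ∎

  poch-nonZero : ∀ k {a} → (∀ j → j < k → NonZero (a + ι j)) → NonZero (poch a k)
  poch-nonZero zero h = 1-nonZero
  poch-nonZero (suc k) h = *-nonZero (poch-nonZero k (λ j j<k → h j (NP.m<n⇒m<1+n j<k))) (h k NP.≤-refl)

  poch-top≈0 : ∀ m → poch (- ι m) (suc m) ≈ 0#
  poch-top≈0 m = trans (*-cong refl (trans (+-comm _ _) (-‿inverseʳ _))) (zeroʳ _)

  fact-nonZero : ∀ k → NonZero (fact k)
  fact-nonZero k = poch-nonZero k (λ j _ → char0 j)

  sgn-square : ∀ k → sgn k * sgn k ≈ 1#
  sgn-square zero = *-identityˡ 1#
  sgn-square (suc k) = trans (solve 1 (λ s → (s :* (:- con (+ 1))) :* (s :* (:- con (+ 1))) := s :* s) refl (sgn k)) (sgn-square k)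

  pow-nonZero : ∀ k {a} → NonZero a → NonZero (pow a k)
  pow-nonZero zero h = 1-nonZero
  pow-nonZero (suc k) h = *-nonZero (pow-nonZero k h) h

  sgn-nonZero : ∀ n → NonZero (sgn n)
  sgn-nonZero n = pow-nonZero n (-‿nonZero 1-nonZero)

  sgn⁻¹ : ∀ n → sgn n ⁻¹ ≈ sgn n
  sgn⁻¹ n = sym (⁻¹-unique (sgn-nonZero n) (sgn-square n))

  recurrence-unique : ∀ K (u v p q : ℕ → Carrier) → (∀ k → k < K → NonZero (p k)) →
    (∀ k → k < K → u (suc k) * p k ≈ u k * q k) →
    (∀ k → k < K → v (suc k) * p k ≈ v k * q k) →
    u 0 ≈ v 0 → ∀ k → k ≤ K → u k ≈ v k
  recurrence-unique K u v p q p≉0 u-rec v-rec u0≈v0 zero _ = u0≈v0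
  recurrence-unique K u v p q p≉0 u-rec v-rec u0≈v0 (suc k) k<K = *-cancelʳ (p≉0 k k<K) (begin
    u (suc k) * p k  ≈⟨ u-rec k k<K ⟩
    u k * q k        ≈⟨ *-cong (recurrence-unique K u v p q p≉0 u-rec v-rec u0≈v0 k (NP.<⇒≤ k<K)) refl ⟩
    v k * q k        ≈⟨ sym (v-rec k k<K) ⟩
    v (suc k) * p k  ∎)

module Weights {c ℓ} (F : Field0 c ℓ) where
  open SumLemmas F public

  half : Carrier
  half = 1# ÷ ι 2

  ¾ : Carrier
  ¾ = ι 3 ÷ ι 4

  eParam : ℕ → Carrier
  eParam n = - ι (1 N.+ 3 N.* n)

  Φ : ℕ → ℕ → Carrier → Carrier
  Φ n l a = F32 a (1# - ι l - a) n half (eParam n) ¾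

  weight : ℕ → ℕ → Carrier
  weight n k = (poch (- ι n) k ÷ (fact k * poch half k * poch (eParam n) k)) * pow ¾ k

  F32-term-split : ∀ a b w den z → ((a * b * w) ÷ den) * z ≈ (a * b) * ((w ÷ den) * z)
  F32-term-split a b w den z =
    solve 5 (λ a b w i z → ((a :* b :* w) :* i) :* z := (a :* b) :* ((w :* i) :* z)) refl a b w (den ⁻¹) z

  odd : ℕ → Carrier
  odd k = 1# + ι 2 * ι k

  odd-nonZero : ∀ k → NonZero (odd k)
  odd-nonZero k = NonZero-resp ι≈odd (char0 (k N.+ k))
    where
    ι≈odd : ι (suc (k N.+ k)) ≈ odd k
    ι≈odd = +-cong refl (trans (ι-+ k k) (solve 1 (λ x → x :+ x := con (+ 2) :* x) refl (ι k)))

  2*[half+ι]≈odd : ∀ k → ι 2 * (half + ι k) ≈ odd k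
  2*[half+ι]≈odd k = trans (distribˡ _ _ _) (+-cong 2*half≈1 refl)
    where
    2*half≈1 : ι 2 * half ≈ 1#
    2*half≈1 = trans (solve 2 (λ a i → a :* (con (+ 1) :* i) := a :* i) refl (ι 2) (ι 2 ⁻¹)) (⁻¹-inverseʳ (char0 1))

  4*¾≈3 : ι 4 * ¾ ≈ ι 3
  4*¾≈3 = begin
    ι 4 * (ι 3 * ι 4 ⁻¹)  ≈⟨ solve 3 (λ a b i → a :* (b :* i) := b :* (a :* i)) refl (ι 4) (ι 3) (ι 4 ⁻¹) ⟩
    ι 3 * (ι 4 * ι 4 ⁻¹)  ≈⟨ *-cong refl (⁻¹-inverseʳ (char0 3)) ⟩
    ι 3 * 1#              ≈⟨ *-identityʳ _ ⟩
    ι 3                   ∎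

  half+ι-nonZero : ∀ k → NonZero (half + ι k)
  half+ι-nonZero k e = odd-nonZero k (trans (sym (2*[half+ι]≈odd k)) (trans (*-cong refl e) (zeroʳ _)))

  eParam+ι-nonZero : ∀ n k → k ≤ 3 N.* n → NonZero (eParam n + ι k)
  eParam+ι-nonZero n k k≤ = -ι+ι-nonZero (s≤s k≤)

  weight-denominator-nonZero : ∀ n k → k ≤ suc (3 N.* n) → NonZero (fact k * poch half k * poch (eParam n) k)
  weight-denominator-nonZero n k k≤ =
    *-nonZero (*-nonZero (fact-nonZero k) (poch-nonZero k (λ j _ → half+ι-nonZero j)))
              (poch-nonZero k (λ j j<k → eParam+ι-nonZero n j (NP.≤-pred (NP.≤-trans j<k k≤))))

  weight-ratio : ∀ n k → k ≤ 3 N.* n →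
    weight n (suc k) * ((1# + ι k) * (half + ι k) * (eParam n + ι k)) ≈ weight n k * ((- ι n + ι k) * ¾)
  weight-ratio n k k≤ = begin
    ((W * m) * Den' ⁻¹) * (Zk * ¾) * Pp          ≈⟨ *-cong (*-cong (*-cong refl (⁻¹-cong nzDen' eqDen)) refl) refl ⟩
    ((W * m) * (B * Pp) ⁻¹) * (Zk * ¾) * Pp      ≈⟨ *-cong (*-cong (*-cong refl (⁻¹-distrib-* nzB nzP)) refl) refl ⟩
    ((W * m) * (B ⁻¹ * Pp ⁻¹)) * (Zk * ¾) * Pp
      ≈⟨ solve 7 (λ W m Bi Ii Zk z P → ((W :* m) :* (Bi :* Ii)) :* (Zk :* z) :* P
                   := ((W :* Bi) :* Zk) :* (m :* z) :* (P :* Ii)) refl W m (B ⁻¹) (Pp ⁻¹) Zk ¾ Pp ⟩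
    ((W * B ⁻¹) * Zk) * (m * ¾) * (Pp * Pp ⁻¹)   ≈⟨ *-cong refl (⁻¹-inverseʳ nzP) ⟩
    ((W * B ⁻¹) * Zk) * (m * ¾) * 1#             ≈⟨ *-identityʳ _ ⟩
    weight n k * (m * ¾)                         ∎
    where
    W = poch (- ι n) k
    f = fact k
    pd = poch half k
    pe = poch (eParam n) k
    Zk = pow ¾ k
    u = 1# + ι k
    v = half + ι k
    w = eParam n + ι k
    m = - ι n + ι k
    B = f * pd * pe
    Pp = u * v * w
    Den' = (f * u) * (pd * v) * (pe * w)
    eqDen : Den' ≈ B * Pp
    eqDen = solve 6 (λ f u pd v pe w → (f :* u) :* (pd :* v) :* (pe :* w) := (f :* pd :* pe) :* (u :* v :* w))
              refl f u pd v pe w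
    nzB : NonZero B
    nzB = weight-denominator-nonZero n k (NP.m≤n⇒m≤1+n k≤)
    nzP : NonZero Pp
    nzP = *-nonZero (*-nonZero (char0 k) (half+ι-nonZero k)) (eParam+ι-nonZero n k k≤)
    nzDen' : NonZero Den'
    nzDen' = weight-denominator-nonZero n (suc k) (s≤s k≤)

  weight-zero : ∀ n → weight n 0 ≈ 1#
  weight-zero n = begin
    (1# * (1# * 1# * 1#) ⁻¹) * 1#  ≈⟨ trans (*-identityʳ _) (*-identityˡ _) ⟩
    (1# * 1# * 1#) ⁻¹              ≈⟨ ⁻¹-cong (NonZero-resp (sym 1*1*1≈1) 1-nonZero) 1*1*1≈1 ⟩
    1# ⁻¹                          ≈⟨ 1⁻¹≈1 ⟩
    1#                             ∎
    where
    1*1*1≈1 : 1# * 1# * 1# ≈ 1#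
    1*1*1≈1 = trans (*-identityʳ _) (*-identityʳ _)

  weight-top : ∀ n → weight n (suc n) ≈ 0#
  weight-top n = begin
    (poch (- ι n) (suc n) * _ ⁻¹) * _  ≈⟨ *-cong (*-cong (poch-top≈0 n) refl) refl ⟩
    (0# * _ ⁻¹) * _                    ≈⟨ trans (*-cong (zeroˡ _) refl) (zeroˡ _) ⟩
    0#                                 ∎

  Π₂₄ : ℕ → Carrier
  Π₂₄ zero = 1#
  Π₂₄ (suc n) = Π₂₄ n * ((ι 2 + ι 3 * ι n) * (ι 4 + ι 3 * ι n))

  ±Π₂₄ : ℕ → Carrier
  ±Π₂₄ n = sgn n * Π₂₄ n

  Π₂₄-nonZero : ∀ n → NonZero (Π₂₄ n)
  Π₂₄-nonZero zero = 1-nonZero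
  Π₂₄-nonZero (suc n) =
    *-nonZero (Π₂₄-nonZero n) (*-nonZero (NonZero-resp (ι-c+3n 2) (char0 (1 N.+ 3 N.* n)))
                                          (NonZero-resp (ι-c+3n 4) (char0 (3 N.+ 3 N.* n))))
    where
    ι-c+3n : ∀ c → ι (c N.+ 3 N.* n) ≈ ι c + ι 3 * ι n
    ι-c+3n c = trans (ι-+ c (3 N.* n)) (+-cong refl (ι-* 3 n))

  ±Π₂₄-nonZero : ∀ n → NonZero (±Π₂₄ n)
  ±Π₂₄-nonZero n = *-nonZero (sgn-nonZero n) (Π₂₄-nonZero n)

  -- The coefficient of ω₁ k in ω₃ n (ω₃-in-ω₁-basis): up to the factor ±Π₂₄ n (-1)ᵏ / (2k+1), the k-th term of Φ n 0.
  α : ℕ → ℕ → Carrier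
  α n k = (±Π₂₄ n * sgn k * weight n k) ÷ odd k

  α*odd : ∀ n k → α n k * odd k ≈ ±Π₂₄ n * sgn k * weight n k
  α*odd n k = ÷-*-cancel (odd-nonZero k)

  ratioDen : ℕ → ℕ → Carrier
  ratioDen n k = (ι 3 + ι 2 * ι k) * (ι 2 + ι 2 * ι k) * (eParam n + ι k)

  ratioNum : ℕ → ℕ → Carrier
  ratioNum n k = ι 3 * (ι n - ι k)

  α-ratio : ∀ n k → k ≤ 3 N.* n → α n (suc k) * ratioDen n k ≈ α n k * ratioNum n k
  α-ratio n k k≤ = *-cancelʳ (odd-nonZero k) (begin
    (α n (suc k) * ratioDen n k) * odd k
      ≈⟨ solve 4 (λ a1 K w o → (a1 :* ((con (+ 3) :+ con (+ 2) :* K) :* (con (+ 2) :+ con (+ 2) :* K) :* w)) :* o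
                   := (a1 :* (con (+ 1) :+ con (+ 2) :* (con (+ 1) :+ K))) :* ((con (+ 2) :+ con (+ 2) :* K) :* w :* o))
           refl (α n (suc k)) (ι k) w (odd k) ⟩
    (α n (suc k) * odd (suc k)) * ((ι 2 + ι 2 * ι k) * w * odd k)
      ≈⟨ *-cong (α*odd n (suc k)) (*-cong refl (sym (2*[half+ι]≈odd k))) ⟩
    (±Π₂₄ n * sgn (suc k) * weight n (suc k)) * ((ι 2 + ι 2 * ι k) * w * (ι 2 * v))
      ≈⟨ solve 6 (λ S s C1 K w v → (S :* (s :* (:- con (+ 1))) :* C1) :* ((con (+ 2) :+ con (+ 2) :* K) :* w :* (con (+ 2) :* v))
                   := :- (S :* s) :* (C1 :* ((con (+ 1) :+ K) :* v :* w)) :* con (+ 4))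
           refl (±Π₂₄ n) (sgn k) (weight n (suc k)) (ι k) w v ⟩
    - (±Π₂₄ n * sgn k) * (weight n (suc k) * ((1# + ι k) * v * w)) * ι 4
      ≈⟨ *-cong (*-cong refl (weight-ratio n k k≤)) refl ⟩
    - (±Π₂₄ n * sgn k) * (weight n k * (m * ¾)) * ι 4
      ≈⟨ solve 6 (λ S s C0 m z f → :- (S :* s) :* (C0 :* (m :* z)) :* f := (S :* s :* C0) :* (:- m) :* (f :* z))
           refl (±Π₂₄ n) (sgn k) (weight n k) m ¾ (ι 4) ⟩
    (±Π₂₄ n * sgn k * weight n k) * (- m) * (ι 4 * ¾)
      ≈⟨ *-cong (*-cong (sym (α*odd n k)) refl) 4*¾≈3 ⟩
    (α n k * odd k) * (- m) * ι 3
      ≈⟨ solve 4 (λ a o N K → (a :* o) :* (:- (:- N :+ K)) :* con (+ 3) := (a :* (con (+ 3) :* (N :- K))) :* o)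
           refl (α n k) (odd k) (ι n) (ι k) ⟩
    (α n k * ratioNum n k) * odd k ∎)
    where
    w = eParam n + ι k
    v = half + ι k
    m = - ι n + ι k

  α-zero : ∀ n → α n 0 ≈ ±Π₂₄ n
  α-zero n = begin
    (±Π₂₄ n * 1# * weight n 0) * odd 0 ⁻¹  ≈⟨ *-cong (*-cong refl (weight-zero n)) (⁻¹-cong (odd-nonZero 0) odd0≈1) ⟩
    (±Π₂₄ n * 1# * 1#) * 1# ⁻¹             ≈⟨ *-cong refl 1⁻¹≈1 ⟩
    (±Π₂₄ n * 1# * 1#) * 1#                ≈⟨ solve 1 (λ s → s :* con (+ 1) :* con (+ 1) :* con (+ 1) := s) refl (±Π₂₄ n) ⟩
    ±Π₂₄ n                                 ∎
    where
    odd0≈1 : odd 0 ≈ 1#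
    odd0≈1 = trans (+-cong refl (zeroʳ _)) (+-identityʳ _)

  α-top : ∀ n → α n (suc n) ≈ 0#
  α-top n = begin
    (±Π₂₄ n * sgn (suc n) * weight n (suc n)) * odd (suc n) ⁻¹  ≈⟨ *-cong (*-cong refl (weight-top n)) refl ⟩
    (±Π₂₄ n * sgn (suc n) * 0#) * odd (suc n) ⁻¹                ≈⟨ trans (*-cong (zeroʳ _) refl) (zeroˡ _) ⟩
    0#                                                          ∎

module BasisChange {c ℓ} (F : Field0 c ℓ) where
  open Weights F public

  ω₁ : ℕ → Carrier → Carrier
  ω₁ zero s = s
  ω₁ (suc k) s = ω₁ k s * ((s - ι (suc k)) * (s + ι (suc k)))

  ω₃ : ℕ → Carrier → Carrier
  ω₃ zero s = s
  ω₃ (suc n) s = ω₃ n s * ((s - ι 3 * ι (suc n)) * (s + ι 3 * ι (suc n)))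

  P' : Carrier → Carrier → Carrier
  P' N K = (ι 3 + ι 2 * K) * (ι 2 + ι 2 * K) * (- (1# + ι 3 * N) + K)

  Q' : Carrier → Carrier → Carrier
  Q' N K = ι 3 * (N - K)

  A' : Carrier → Carrier → Carrier
  A' N K = (1# + K) * (1# + K) - (ι 3 * (1# + N)) * (ι 3 * (1# + N))

  :P' :Q' :A' : ∀ {m} → Polynomial m → Polynomial m → Polynomial m
  :P' N K = (con (+ 3) :+ con (+ 2) :* K) :* (con (+ 2) :+ con (+ 2) :* K) :* (:- (con (+ 1) :+ con (+ 3) :* N) :+ K)
  :Q' N K = con (+ 3) :* (N :- K)
  :A' N K = (con (+ 1) :+ K) :* (con (+ 1) :+ K) :- (con (+ 3) :* (con (+ 1) :+ N)) :* (con (+ 3) :* (con (+ 1) :+ N))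

  ratioDen≈P' : ∀ n k → ratioDen n k ≈ P' (ι n) (ι k)
  ratioDen≈P' n k = *-cong refl (+-cong eParam≈ refl)
    where
    eParam≈ : eParam n ≈ - (1# + ι 3 * ι n)
    eParam≈ = -‿cong (trans (ι-+ 1 (3 N.* n)) (+-cong (+-identityʳ 1#) (ι-* 3 n)))

  ratioDen-nonZero : ∀ n k → k ≤ 3 N.* n → NonZero (ratioDen n k)
  ratioDen-nonZero n k k≤ =
    *-nonZero (*-nonZero (NonZero-resp (ι-c+2k 3) (char0 (2 N.+ (k N.+ k))))
                         (NonZero-resp (ι-c+2k 2) (char0 (1 N.+ (k N.+ k)))))
              (eParam+ι-nonZero n k k≤)
    where
    ι-c+2k : ∀ c → ι (c N.+ (k N.+ k)) ≈ ι c + ι 2 * ι k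
    ι-c+2k c = trans (ι-+ c (k N.+ k)) (+-cong refl (trans (ι-+ k k) (solve 1 (λ x → x :+ x := con (+ 2) :* x) refl (ι k))))

  -- s² - 9(n+1)² = (s² - (k+1)²) + Aₙₖ n k
  Aₙₖ : ℕ → ℕ → Carrier
  Aₙₖ n k = A' (ι n) (ι k)

  ω₁-step : ∀ n k s → ω₁ k s * ((s - ι 3 * ι (suc n)) * (s + ι 3 * ι (suc n))) ≈ ω₁ (suc k) s + Aₙₖ n k * ω₁ k s
  ω₁-step n k s = solve 4 (λ E s K N → E :* ((s :- con (+ 3) :* (con (+ 1) :+ N)) :* (s :+ con (+ 3) :* (con (+ 1) :+ N)))
       := E :* ((s :- (con (+ 1) :+ K)) :* (s :+ (con (+ 1) :+ K))) :+ :A' N K :* E) refl (ω₁ k s) s (ι k) (ι n)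

  -- The coefficients of ω₃ (suc n) obtained from those of ω₃ n by ω₁-step.
  β : ℕ → ℕ → Carrier
  β n zero = Aₙₖ n 0 * α n 0
  β n (suc k) = α n k + Aₙₖ n (suc k) * α n (suc k)

  β-ratio-identity-zero : ∀ N a →
    P' (1# + N) 0# * (a * P' N 0# + A' N (1# + 0#) * (a * Q' N 0#))
    ≈ (A' N 0# * a) * Q' (1# + N) 0# * P' N 0#
  β-ratio-identity-zero = solve 2 (λ N a →
    :P' (con (+ 1) :+ N) (con (+ 0)) :* (a :* :P' N (con (+ 0)) :+ :A' N (con (+ 1) :+ con (+ 0)) :* (a :* :Q' N (con (+ 0))))
    := (:A' N (con (+ 0)) :* a) :* :Q' (con (+ 1) :+ N) (con (+ 0)) :* :P' N (con (+ 0))) refl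

  β-ratio-identity-suc : ∀ N J a →
    P' (1# + N) (1# + J) * (a * Q' N J) * (P' N (1# + J) + A' N (1# + (1# + J)) * Q' N (1# + J))
    ≈ Q' (1# + N) (1# + J) * P' N (1# + J) * (a * P' N J + A' N (1# + J) * (a * Q' N J))
  β-ratio-identity-suc = solve 3 (λ N J a →
    :P' (con (+ 1) :+ N) (con (+ 1) :+ J) :* (a :* :Q' N J)
      :* (:P' N (con (+ 1) :+ J) :+ :A' N (con (+ 1) :+ (con (+ 1) :+ J)) :* :Q' N (con (+ 1) :+ J))
    := :Q' (con (+ 1) :+ N) (con (+ 1) :+ J) :* :P' N (con (+ 1) :+ J)
      :* (a :* :P' N J :+ :A' N (con (+ 1) :+ J) :* (a :* :Q' N J))) refl

  -- After clearing denominators with α-ratio, both cases are the polynomial identities above.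
  β-ratio : ∀ n k → k ≤ n → β n (suc k) * ratioDen (suc n) k ≈ β n k * ratioNum (suc n) k
  β-ratio n zero _ = *-cancelʳ (ratioDen-nonZero n 0 z≤n) (begin
    (α n 0 + A1 * α n 1) * ratioDen (suc n) 0 * ratioDen n 0
      ≈⟨ solve 5 (λ a0 A1 a1 X p → (a0 :+ A1 :* a1) :* X :* p := X :* (a0 :* p :+ A1 :* (a1 :* p)))
           refl (α n 0) A1 (α n 1) (ratioDen (suc n) 0) (ratioDen n 0) ⟩
    ratioDen (suc n) 0 * (α n 0 * ratioDen n 0 + A1 * (α n 1 * ratioDen n 0))
      ≈⟨ *-cong refl (+-cong refl (*-cong refl (α-ratio n 0 z≤n))) ⟩
    ratioDen (suc n) 0 * (α n 0 * ratioDen n 0 + A1 * (α n 0 * ratioNum n 0))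
      ≈⟨ *-cong (ratioDen≈P' (suc n) 0) (+-cong (*-cong refl (ratioDen≈P' n 0)) refl) ⟩
    P' (1# + ι n) 0# * (α n 0 * P' (ι n) 0# + A1 * (α n 0 * ratioNum n 0))
      ≈⟨ β-ratio-identity-zero (ι n) (α n 0) ⟩
    (Aₙₖ n 0 * α n 0) * ratioNum (suc n) 0 * P' (ι n) 0#
      ≈⟨ *-cong refl (sym (ratioDen≈P' n 0)) ⟩
    (Aₙₖ n 0 * α n 0) * ratioNum (suc n) 0 * ratioDen n 0 ∎)
    where
    A1 = Aₙₖ n 1
  β-ratio n (suc j) j<n = *-cancelʳ (*-nonZero (ratioDen-nonZero n j j≤) (ratioDen-nonZero n (suc j) j1≤)) (begin
    (α n (suc j) + A2 * α n (suc (suc j))) * X * (pj * pj1)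
      ≈⟨ solve 6 (λ a1 A2 a2 X pj pj1 → (a1 :+ A2 :* a2) :* X :* (pj :* pj1) := X :* pj :* (a1 :* pj1 :+ A2 :* (a2 :* pj1)))
           refl (α n (suc j)) A2 (α n (suc (suc j))) X pj pj1 ⟩
    X * pj * (α n (suc j) * pj1 + A2 * (α n (suc (suc j)) * pj1))
      ≈⟨ *-cong refl (+-cong refl (*-cong refl (α-ratio n (suc j) j1≤))) ⟩
    X * pj * (α n (suc j) * pj1 + A2 * (α n (suc j) * qj1))
      ≈⟨ solve 6 (λ X pj a1 pj1 A2 qj1 → X :* pj :* (a1 :* pj1 :+ A2 :* (a1 :* qj1)) := X :* (a1 :* pj) :* (pj1 :+ A2 :* qj1))
           refl X pj (α n (suc j)) pj1 A2 qj1 ⟩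
    X * (α n (suc j) * pj) * (pj1 + A2 * qj1)
      ≈⟨ *-cong (*-cong refl (α-ratio n j j≤)) refl ⟩
    X * (α n j * qj) * (pj1 + A2 * qj1)
      ≈⟨ *-cong (*-cong (ratioDen≈P' (suc n) (suc j)) refl) (+-cong (ratioDen≈P' n (suc j)) refl) ⟩
    P' (1# + ι n) (1# + ι j) * (α n j * qj) * (P' (ι n) (1# + ι j) + A2 * qj1)
      ≈⟨ β-ratio-identity-suc (ι n) (ι j) (α n j) ⟩
    Y * P' (ι n) (1# + ι j) * (α n j * P' (ι n) (ι j) + A1 * (α n j * qj))
      ≈⟨ *-cong (*-cong refl (sym (ratioDen≈P' n (suc j)))) (+-cong (*-cong refl (sym (ratioDen≈P' n j))) refl) ⟩
    Y * pj1 * (α n j * pj + A1 * (α n j * qj))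
      ≈⟨ *-cong refl (+-cong refl (*-cong refl (sym (α-ratio n j j≤)))) ⟩
    Y * pj1 * (α n j * pj + A1 * (α n (suc j) * pj))
      ≈⟨ solve 6 (λ Y pj1 a0 pj A1 a1 → Y :* pj1 :* (a0 :* pj :+ A1 :* (a1 :* pj)) := (a0 :+ A1 :* a1) :* Y :* (pj :* pj1))
           refl Y pj1 (α n j) pj A1 (α n (suc j)) ⟩
    (α n j + A1 * α n (suc j)) * Y * (pj * pj1) ∎)
    where
    A1 = Aₙₖ n (suc j)
    A2 = Aₙₖ n (suc (suc j))
    X = ratioDen (suc n) (suc j)
    Y = ratioNum (suc n) (suc j)
    pj = ratioDen n j
    pj1 = ratioDen n (suc j)
    qj = ratioNum n j
    qj1 = ratioNum n (suc j)
    j1≤ : suc j ≤ 3 N.* n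
    j1≤ = NP.≤-trans j<n (NP.m≤n*m n 3)
    j≤ : j ≤ 3 N.* n
    j≤ = NP.≤-trans (NP.n≤1+n j) j1≤

  α-suc≈β : ∀ n k → k ≤ suc n → α (suc n) k ≈ β n k
  α-suc≈β n = recurrence-unique (suc n) (α (suc n)) (β n) (ratioDen (suc n)) (ratioNum (suc n))
    (λ k k< → ratioDen-nonZero (suc n) k (k≤3[1+n] k k<))
    (λ k k< → α-ratio (suc n) k (k≤3[1+n] k k<))
    (λ k k< → β-ratio n k (NP.≤-pred k<))
    (begin
      α (suc n) 0
        ≈⟨ α-zero (suc n) ⟩
      sgn n * - 1# * (Π₂₄ n * ((ι 2 + ι 3 * ι n) * (ι 4 + ι 3 * ι n)))
        ≈⟨ solve 3 (λ s D N → s :* (:- con (+ 1)) :* (D :* ((con (+ 2) :+ con (+ 3) :* N) :* (con (+ 4) :+ con (+ 3) :* N)))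
                      := :A' N (con (+ 0)) :* (s :* D)) refl (sgn n) (Π₂₄ n) (ι n) ⟩
      Aₙₖ n 0 * ±Π₂₄ n
        ≈⟨ *-cong refl (sym (α-zero n)) ⟩
      Aₙₖ n 0 * α n 0 ∎)
    where
    k≤3[1+n] : ∀ k → k < suc n → k ≤ 3 N.* suc n
    k≤3[1+n] k k< = NP.≤-trans (NP.≤-pred k<) (NP.≤-trans (NP.n≤1+n n) (NP.m≤n*m (suc n) 3))

  ω₃-in-ω₁-basis : ∀ n s → ω₃ n s ≈ sumTo n (λ k → α n k * ω₁ k s)
  ω₃-in-ω₁-basis zero s = sym (trans (*-cong (α-zero 0) refl) (trans (*-cong (*-identityˡ 1#) refl) (*-identityˡ s)))
  ω₃-in-ω₁-basis (suc n) s = begin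
    ω₃ n s * M                              ≈⟨ *-cong (ω₃-in-ω₁-basis n s) refl ⟩
    sumTo n (λ k → α n k * ω₁ k s) * M      ≈⟨ *-comm _ _ ⟩
    M * sumTo n (λ k → α n k * ω₁ k s)      ≈⟨ *-distribˡ-sumTo n M _ ⟩
    sumTo n (λ k → M * (α n k * ω₁ k s))    ≈⟨ sumTo-cong n (λ k _ → split k) ⟩
    sumTo n (λ k → up k + stay k)           ≈⟨ sumTo-+ n up stay ⟩
    sumTo n up + sumTo n stay               ≈⟨ sumTo-+-shifted n up stay (λ k → α (suc n) k * ω₁ k s) stay-top≈0 coeff₀ coeffₖ ⟩
    sumTo (suc n) (λ k → α (suc n) k * ω₁ k s) ∎
    where
    M = (s - ι 3 * ι (suc n)) * (s + ι 3 * ι (suc n))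
    up stay : ℕ → Carrier
    up k = α n k * ω₁ (suc k) s
    stay k = α n k * (Aₙₖ n k * ω₁ k s)
    split : ∀ k → M * (α n k * ω₁ k s) ≈ up k + stay k
    split k = begin
      M * (α n k * ω₁ k s)                        ≈⟨ solve 3 (λ M a E → M :* (a :* E) := a :* (E :* M)) refl M (α n k) (ω₁ k s) ⟩
      α n k * (ω₁ k s * M)                        ≈⟨ *-cong refl (ω₁-step n k s) ⟩
      α n k * (ω₁ (suc k) s + Aₙₖ n k * ω₁ k s)   ≈⟨ distribˡ _ _ _ ⟩
      up k + stay k                               ∎
    stay-top≈0 : stay (suc n) ≈ 0#
    stay-top≈0 = trans (*-cong (α-top n) refl) (zeroˡ _)
    coeff₀ : stay 0 ≈ α (suc n) 0 * ω₁ 0 s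
    coeff₀ = trans (sym (*-assoc _ _ _)) (*-cong (trans (*-comm _ _) (sym (α-suc≈β n 0 z≤n))) refl)
    coeffₖ : ∀ k → k ≤ n → up k + stay (suc k) ≈ α (suc n) (suc k) * ω₁ (suc k) s
    coeffₖ k k≤ = begin
      α n k * ω₁ (suc k) s + α n (suc k) * (Aₙₖ n (suc k) * ω₁ (suc k) s)
        ≈⟨ solve 4 (λ a E b A → a :* E :+ b :* (A :* E) := (a :+ A :* b) :* E) refl (α n k) (ω₁ (suc k) s) (α n (suc k)) (Aₙₖ n (suc k)) ⟩
      β n (suc k) * ω₁ (suc k) s
        ≈⟨ *-cong (sym (α-suc≈β n (suc k) (s≤s k≤))) refl ⟩
      α (suc n) (suc k) * ω₁ (suc k) s ∎

module ClosedFormAtZero {c ℓ} (F : Field0 c ℓ) where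
  open BasisChange F public

  ω₁≈poch : ∀ k s → ω₁ k s ≈ sgn k * poch (1# - s) k * poch s (suc k)
  ω₁≈poch zero s = solve 1 (λ s → s := con (+ 1) :* con (+ 1) :* (con (+ 1) :* (s :+ con (+ 0)))) refl s
  ω₁≈poch (suc k) s = begin
    ω₁ k s * ((s - (1# + ι k)) * (s + (1# + ι k)))
      ≈⟨ *-cong (ω₁≈poch k s) refl ⟩
    (sgn k * poch (1# - s) k * (poch s k * (s + ι k))) * ((s - (1# + ι k)) * (s + (1# + ι k)))
      ≈⟨ solve 5 (λ g P1 P2 s K → (g :* P1 :* (P2 :* (s :+ K))) :* ((s :- (con (+ 1) :+ K)) :* (s :+ (con (+ 1) :+ K)))
            := (g :* (:- con (+ 1))) :* (P1 :* ((con (+ 1) :- s) :+ K)) :* ((P2 :* (s :+ K)) :* (s :+ (con (+ 1) :+ K))))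
           refl (sgn k) (poch (1# - s) k) (poch s k) s (ι k) ⟩
    sgn (suc k) * poch (1# - s) (suc k) * poch s (suc (suc k)) ∎

  ω₁-difference : ∀ k s → ω₁ k s - ω₁ k (s - 1#) ≈ odd k * (sgn k * (poch s k * poch (1# - s) k))
  ω₁-difference k s = begin
    ω₁ k s - ω₁ k (s - 1#)
      ≈⟨ +-cong (ω₁≈poch k s) (-‿cong (ω₁≈poch k (s - 1#))) ⟩
    sgn k * P1 * (P2 * (s + ι k)) - sgn k * Y * poch (s - 1#) (suc k)
      ≈⟨ +-cong refl (-‿cong (*-cong refl (poch-suc-shift k (solve 1 (λ s → s := (s :- con (+ 1)) :+ con (+ 1)) refl s)))) ⟩
    sgn k * P1 * (P2 * (s + ι k)) - sgn k * Y * ((s - 1#) * P2)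
      ≈⟨ solve 6 (λ g P1 P2 Y s K → g :* P1 :* (P2 :* (s :+ K)) :- g :* Y :* ((s :- con (+ 1)) :* P2)
                   := g :* P2 :* (P1 :* (s :+ K) :+ (con (+ 1) :- s) :* Y)) refl (sgn k) P1 P2 Y s (ι k) ⟩
    sgn k * P2 * (P1 * (s + ι k) + (1# - s) * Y)
      ≈⟨ *-cong refl (+-cong refl (sym (poch-suc-shift k
           (solve 1 (λ s → con (+ 1) :- (s :- con (+ 1)) := (con (+ 1) :- s) :+ con (+ 1)) refl s)))) ⟩
    sgn k * P2 * (P1 * (s + ι k) + P1 * ((1# - s) + ι k))
      ≈⟨ solve 5 (λ g P1 P2 s K → g :* P2 :* (P1 :* (s :+ K) :+ P1 :* ((con (+ 1) :- s) :+ K))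
                   := (con (+ 1) :+ con (+ 2) :* K) :* (g :* (P2 :* P1))) refl (sgn k) P1 P2 s (ι k) ⟩
    odd k * (sgn k * (P2 * P1)) ∎
    where
    P1 = poch (1# - s) k
    P2 = poch s k
    Y = poch (1# - (s - 1#)) k

  Φ₀-difference : ∀ n s → Φ n 0 s ≈ ±Π₂₄ n ⁻¹ * (ω₃ n s - ω₃ n (s - 1#))
  Φ₀-difference n s = begin
    Φ n 0 s
      ≈⟨ sumTo-cong n (λ k _ → term k) ⟩
    sumTo n (λ k → ±Π₂₄ n ⁻¹ * (α n k * ω₁ k s - α n k * ω₁ k (s - 1#)))
      ≈⟨ sym (*-distribˡ-sumTo n _ _) ⟩
    ±Π₂₄ n ⁻¹ * sumTo n (λ k → α n k * ω₁ k s - α n k * ω₁ k (s - 1#))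
      ≈⟨ *-cong refl (sumTo-minus n _ _) ⟩
    ±Π₂₄ n ⁻¹ * (sumTo n (λ k → α n k * ω₁ k s) - sumTo n (λ k → α n k * ω₁ k (s - 1#)))
      ≈⟨ *-cong refl (+-cong (sym (ω₃-in-ω₁-basis n s)) (-‿cong (sym (ω₃-in-ω₁-basis n (s - 1#))))) ⟩
    ±Π₂₄ n ⁻¹ * (ω₃ n s - ω₃ n (s - 1#)) ∎
    where
    term : ∀ k → ((poch s k * poch (1# - ι 0 - s) k * poch (- ι n) k) ÷ (fact k * poch half k * poch (eParam n) k)) * pow ¾ k
                 ≈ ±Π₂₄ n ⁻¹ * (α n k * ω₁ k s - α n k * ω₁ k (s - 1#))
    term k = begin
      _
        ≈⟨ F32-term-split _ _ _ _ _ ⟩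
      (poch s k * poch (1# - ι 0 - s) k) * weight n k
        ≈⟨ *-cong (*-cong refl (poch-cong k (solve 1 (λ s → con (+ 1) :- con (+ 0) :- s := con (+ 1) :- s) refl s))) refl ⟩
      (poch s k * poch (1# - s) k) * weight n k
        ≈⟨ solve 3 (λ P1 P2 C → P1 :* P2 :* C := (con (+ 1) :* con (+ 1)) :* (P1 :* P2 :* C)) refl (poch s k) (poch (1# - s) k) (weight n k) ⟩
      (1# * 1#) * (poch s k * poch (1# - s) k * weight n k)
        ≈⟨ *-cong (*-cong (sym (⁻¹-inverseˡ (±Π₂₄-nonZero n))) (sym (sgn-square k))) refl ⟩
      ((±Π₂₄ n ⁻¹ * ±Π₂₄ n) * (sgn k * sgn k)) * (poch s k * poch (1# - s) k * weight n k)
        ≈⟨ solve 6 (λ I S g P1 P2 C → ((I :* S) :* (g :* g)) :* (P1 :* P2 :* C)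
               := I :* (((S :* g :* C) :* g) :* (P1 :* P2))) refl (±Π₂₄ n ⁻¹) (±Π₂₄ n) (sgn k) (poch s k) (poch (1# - s) k) (weight n k) ⟩
      ±Π₂₄ n ⁻¹ * (((±Π₂₄ n * sgn k * weight n k) * sgn k) * (poch s k * poch (1# - s) k))
        ≈⟨ *-cong refl (*-cong (*-cong (sym (α*odd n k)) refl) refl) ⟩
      ±Π₂₄ n ⁻¹ * (((α n k * odd k) * sgn k) * (poch s k * poch (1# - s) k))
        ≈⟨ *-cong refl (solve 5 (λ a o g P Q → ((a :* o) :* g) :* (P :* Q) := a :* (o :* (g :* (P :* Q))))
                          refl (α n k) (odd k) (sgn k) (poch s k) (poch (1# - s) k)) ⟩
      ±Π₂₄ n ⁻¹ * (α n k * (odd k * (sgn k * (poch s k * poch (1# - s) k))))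
        ≈⟨ *-cong refl (*-cong refl (sym (ω₁-difference k s))) ⟩
      ±Π₂₄ n ⁻¹ * (α n k * (ω₁ k s - ω₁ k (s - 1#)))
        ≈⟨ *-cong refl (solve 3 (λ a x y → a :* (x :- y) := a :* x :- a :* y) refl (α n k) _ _) ⟩
      ±Π₂₄ n ⁻¹ * (α n k * ω₁ k s - α n k * ω₁ k (s - 1#)) ∎

  poch₃ : Carrier → ℕ → Carrier
  poch₃ c zero = 1#
  poch₃ c (suc n) = poch₃ c n * (c + ι 3 * ι n)

  poch-scale₃ : ∀ n {u c} → ι 3 * u ≈ c → poch u n * pow (ι 3) n ≈ poch₃ c n
  poch-scale₃ zero e = *-identityˡ 1#
  poch-scale₃ (suc n) {u} {c} e = begin
    (poch u n * (u + ι n)) * (pow (ι 3) n * ι 3)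
      ≈⟨ solve 4 (λ P u N Q → (P :* (u :+ N)) :* (Q :* con (+ 3)) := (P :* Q) :* (con (+ 3) :* u :+ con (+ 3) :* N))
           refl (poch u n) u (ι n) (pow (ι 3) n) ⟩
    (poch u n * pow (ι 3) n) * (ι 3 * u + ι 3 * ι n)
      ≈⟨ *-cong (poch-scale₃ n e) (+-cong e refl) ⟩
    poch₃ c n * (c + ι 3 * ι n) ∎

  ω₃≈poch₃ : ∀ n t → t * (poch₃ (ι 3 + t) n * poch₃ (ι 3 - t) n) ≈ sgn n * ω₃ n t
  ω₃≈poch₃ zero t = solve 1 (λ t → t :* (con (+ 1) :* con (+ 1)) := con (+ 1) :* t) refl t
  ω₃≈poch₃ (suc n) t = begin
    t * ((pa * (ι 3 + t + ι 3 * ι n)) * (pb * (ι 3 - t + ι 3 * ι n)))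
      ≈⟨ solve 4 (λ t pa pb N → t :* ((pa :* (con (+ 3) :+ t :+ con (+ 3) :* N)) :* (pb :* (con (+ 3) :- t :+ con (+ 3) :* N)))
            := (t :* (pa :* pb)) :* ((con (+ 3) :+ t :+ con (+ 3) :* N) :* (con (+ 3) :- t :+ con (+ 3) :* N))) refl t pa pb (ι n) ⟩
    (t * (pa * pb)) * ((ι 3 + t + ι 3 * ι n) * (ι 3 - t + ι 3 * ι n))
      ≈⟨ *-cong (ω₃≈poch₃ n t) refl ⟩
    (sgn n * ω₃ n t) * ((ι 3 + t + ι 3 * ι n) * (ι 3 - t + ι 3 * ι n))
      ≈⟨ solve 4 (λ g G t N → (g :* G) :* ((con (+ 3) :+ t :+ con (+ 3) :* N) :* (con (+ 3) :- t :+ con (+ 3) :* N))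
            := (g :* (:- con (+ 1))) :* (G :* ((t :- con (+ 3) :* (con (+ 1) :+ N)) :* (t :+ con (+ 3) :* (con (+ 1) :+ N)))))
           refl (sgn n) (ω₃ n t) t (ι n) ⟩
    sgn (suc n) * ω₃ (suc n) t ∎
    where
    pa = poch₃ (ι 3 + t) n
    pb = poch₃ (ι 3 - t) n

  Π₂₄≈poch₃ : ∀ n → Π₂₄ n ≈ poch₃ (ι 2) n * poch₃ (ι 4) n
  Π₂₄≈poch₃ zero = sym (*-identityˡ 1#)
  Π₂₄≈poch₃ (suc n) = trans (*-cong (Π₂₄≈poch₃ n) refl) (interchange _ _ _ _)

  3*[c÷3]≈c : ∀ c → ι 3 * (c ÷ ι 3) ≈ c
  3*[c÷3]≈c c = trans (solve 3 (λ a c i → a :* (c :* i) := c :* (a :* i)) refl (ι 3) c (ι 3 ⁻¹))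
                      (trans (*-cong refl (⁻¹-inverseʳ (char0 2))) (*-identityʳ c))

  bracket≈poch₃ : ∀ n {u₁ u₂ c₁ c₂} → ι 3 * u₁ ≈ c₁ → ι 3 * u₂ ≈ c₂ →
    br2/2 u₁ u₂ (ι 2 ÷ ι 3) (ι 4 ÷ ι 3) n ≈ (poch₃ c₁ n * poch₃ c₂ n) ÷ Π₂₄ n
  bracket≈poch₃ n {u₁} {u₂} {c₁} {c₂} e₁ e₂ = begin
    (poch u₁ n * poch u₂ n) ÷ (poch w₁ n * poch w₂ n)
      ≈⟨ ÷-scale den≉0 3ⁿ3ⁿ≉0 ⟩
    ((poch u₁ n * poch u₂ n) * (3ⁿ * 3ⁿ)) ÷ ((poch w₁ n * poch w₂ n) * (3ⁿ * 3ⁿ))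
      ≈⟨ ÷-cong (*-nonZero den≉0 3ⁿ3ⁿ≉0)
                (trans (interchange _ _ _ _) (*-cong (poch-scale₃ n e₁) (poch-scale₃ n e₂)))
                (trans (interchange _ _ _ _) (trans (*-cong (poch-scale₃ n (3*[c÷3]≈c (ι 2))) (poch-scale₃ n (3*[c÷3]≈c (ι 4))))
                                                    (sym (Π₂₄≈poch₃ n)))) ⟩
    (poch₃ c₁ n * poch₃ c₂ n) ÷ Π₂₄ n ∎
    where
    w₁ = ι 2 ÷ ι 3
    w₂ = ι 4 ÷ ι 3
    3ⁿ = pow (ι 3) n
    3ⁿ3ⁿ≉0 : NonZero (3ⁿ * 3ⁿ)
    3ⁿ3ⁿ≉0 = *-nonZero (pow-nonZero n (char0 2)) (pow-nonZero n (char0 2))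
    thirds-nonZero : ∀ c j → NonZero (ι (c N.+ 3 N.* j)) → NonZero ((ι c ÷ ι 3) + ι j)
    thirds-nonZero c j h e = h (begin
      ι (c N.+ 3 N.* j)              ≈⟨ trans (ι-+ c _) (+-cong refl (ι-* 3 j)) ⟩
      ι c + ι 3 * ι j                ≈⟨ +-cong (sym (3*[c÷3]≈c (ι c))) refl ⟩
      ι 3 * (ι c ÷ ι 3) + ι 3 * ι j  ≈⟨ sym (distribˡ _ _ _) ⟩
      ι 3 * ((ι c ÷ ι 3) + ι j)      ≈⟨ *-cong refl e ⟩
      ι 3 * 0#                       ≈⟨ zeroʳ _ ⟩
      0#                             ∎)
    den≉0 : NonZero (poch w₁ n * poch w₂ n)
    den≉0 = *-nonZero (poch-nonZero n (λ j _ → thirds-nonZero 2 j (char0 (1 N.+ 3 N.* j))))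
                      (poch-nonZero n (λ j _ → thirds-nonZero 4 j (char0 (3 N.+ 3 N.* j))))

  Φ₀-closed-form : ∀ n s {u₁ u₂ v₁ v₂} →
    ι 3 * u₁ ≈ ι 3 + s → ι 3 * u₂ ≈ ι 3 - s → ι 3 * v₁ ≈ ι 2 + s → ι 3 * v₂ ≈ ι 4 - s →
    Φ n 0 s ≈ s * br2/2 u₁ u₂ (ι 2 ÷ ι 3) (ι 4 ÷ ι 3) n - (s - 1#) * br2/2 v₁ v₂ (ι 2 ÷ ι 3) (ι 4 ÷ ι 3) n
  Φ₀-closed-form n s {u₁} {u₂} {v₁} {v₂} e₁ e₂ e₃ e₄ = sym (begin
    s * br2/2 u₁ u₂ w₁ w₂ n - (s - 1#) * br2/2 v₁ v₂ w₁ w₂ n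
      ≈⟨ +-cong (*-cong refl (bracket≈poch₃ n e₁ e₂)) (-‿cong (*-cong refl (bracket≈poch₃ n e₃' e₄'))) ⟩
    s * ((pa * pb) ÷ Π₂₄ n) - (s - 1#) * ((pc * pd) ÷ Π₂₄ n)
      ≈⟨ solve 6 (λ s pa pb pc pd Di → s :* ((pa :* pb) :* Di) :- (s :- con (+ 1)) :* ((pc :* pd) :* Di)
                 := (s :* (pa :* pb)) :* Di :- ((s :- con (+ 1)) :* (pc :* pd)) :* Di) refl s pa pb pc pd (Π₂₄ n ⁻¹) ⟩
    (s * (pa * pb)) * Π₂₄ n ⁻¹ - ((s - 1#) * (pc * pd)) * Π₂₄ n ⁻¹
      ≈⟨ +-cong (*-cong (ω₃≈poch₃ n s) refl) (-‿cong (*-cong (ω₃≈poch₃ n (s - 1#)) refl)) ⟩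
    (sgn n * ω₃ n s) * Π₂₄ n ⁻¹ - (sgn n * ω₃ n (s - 1#)) * Π₂₄ n ⁻¹
      ≈⟨ solve 4 (λ g a b Di → (g :* a) :* Di :- (g :* b) :* Di := (g :* Di) :* (a :- b)) refl (sgn n) (ω₃ n s) (ω₃ n (s - 1#)) (Π₂₄ n ⁻¹) ⟩
    (sgn n * Π₂₄ n ⁻¹) * (ω₃ n s - ω₃ n (s - 1#))
      ≈⟨ *-cong (trans (*-cong (sym (sgn⁻¹ n)) refl) (sym (⁻¹-distrib-* (sgn-nonZero n) (Π₂₄-nonZero n)))) refl ⟩
    ±Π₂₄ n ⁻¹ * (ω₃ n s - ω₃ n (s - 1#))
      ≈⟨ sym (Φ₀-difference n s) ⟩
    Φ n 0 s ∎)
    where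
    w₁ = ι 2 ÷ ι 3
    w₂ = ι 4 ÷ ι 3
    pa = poch₃ (ι 3 + s) n
    pb = poch₃ (ι 3 - s) n
    pc = poch₃ (ι 3 + (s - 1#)) n
    pd = poch₃ (ι 3 - (s - 1#)) n
    e₃' : ι 3 * v₁ ≈ ι 3 + (s - 1#)
    e₃' = trans e₃ (solve 1 (λ s → con (+ 2) :+ s := con (+ 3) :+ (s :- con (+ 1))) refl s)
    e₄' : ι 3 * v₂ ≈ ι 3 - (s - 1#)
    e₄' = trans e₄ (solve 1 (λ s → con (+ 4) :- s := con (+ 3) :- (s :- con (+ 1))) refl s)

module Expansion {c ℓ} (F : Field0 c ℓ) where
  open ClosedFormAtZero F public

  twice : Carrier → Carrier
  twice a = ι 2 * a

  coeff : Carrier → ℕ → ℕ → Carrier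
  coeff a l i = br1/1 a (twice a) l
              * (sgn i * ((twice a + ι 2 * ι i - 1#) ÷ (twice a - 1#)) * br2/2 (- ι l) (twice a - 1#) 1# (twice a + ι l) i)

  coeffNum coeffDen : Carrier → ℕ → ℕ → Carrier
  coeffNum a l i = poch a l * (sgn i * (twice a + ι 2 * ι i - 1#)) * (poch (- ι l) i * poch (twice a - 1#) i)
  coeffDen a l i = poch (twice a) l * (twice a - 1#) * (poch 1# i * poch (twice a + ι l) i)

  Admissible : Carrier → ℕ → Set ℓ
  Admissible a l = NonZero (twice a - 1#) × (∀ j → j < 2 N.* l → NonZero (twice a + ι j))

  +ι-+-nonZero : ∀ {t} l j → NonZero (t + ι (l N.+ j)) → NonZero (t + ι l + ι j)
  +ι-+-nonZero l j h = NonZero-resp (trans (+-cong refl (ι-+ l j)) (sym (+-assoc _ _ _))) h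

  module _ (a : Carrier) (l i : ℕ) (2a-1≉0 : NonZero (twice a - 1#))
           (2a+j≉0 : ∀ j → j < l N.+ i → NonZero (twice a + ι j)) where

    private
      poch-2a≉0 : NonZero (poch (twice a) l)
      poch-2a≉0 = poch-nonZero l (λ j j< → 2a+j≉0 j (NP.≤-trans j< (NP.m≤m+n l i)))

      lower≉0 : NonZero (fact i * poch (twice a + ι l) i)
      lower≉0 = *-nonZero (fact-nonZero i)
                          (poch-nonZero i (λ j j< → +ι-+-nonZero l j (2a+j≉0 (l N.+ j) (NP.+-monoʳ-< l j<))))

    coeffDen-nonZero : NonZero (coeffDen a l i)
    coeffDen-nonZero = *-nonZero (*-nonZero poch-2a≉0 2a-1≉0) lower≉0

    coeff≈num÷den : coeff a l i ≈ coeffNum a l i ÷ coeffDen a l i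
    coeff≈num÷den = ÷-product₃ poch-2a≉0 2a-1≉0 lower≉0

  -- Each coefficient in coeff-recurrence, times a polynomial factor mᵢ, is the common value N0 ÷ D0
  -- times another polynomial mᵢ'; the recurrence then reduces to a polynomial identity.
  module CoeffRecurrence (a : Carrier) (l j : ℕ) where
    t = twice a
    A = poch a l
    L = poch (- ι l) j
    H = poch t j
    T = poch t l
    J = fact j
    V = poch (twice (a + 1#) + ι l) j
    sg = sgn j
    N0 = A * L * H * sg
    D0 = T * J * V
    Lι = ι l
    K = ι j

    eL : poch (- ι (suc l)) (suc j) ≈ (- ι (suc l)) * L
    eL = poch-suc-shift j (solve 1 (λ x → :- x := :- (con (+ 1) :+ x) :+ con (+ 1)) refl (ι l))
    eH : poch (t - 1#) (suc j) ≈ (t - 1#) * H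
    eH = poch-suc-shift j (solve 1 (λ x → x := (x :- con (+ 1)) :+ con (+ 1)) refl t)
    eV : poch (t + ι (suc l)) (suc j) ≈ (t + ι (suc l)) * V
    eV = poch-suc-shift j (solve 2 (λ a x → con (+ 2) :* (a :+ con (+ 1)) :+ x := (con (+ 2) :* a :+ (con (+ 1) :+ x)) :+ con (+ 1)) refl a (ι l))

    m1 = (t + Lι) * (1# + K) * (t + ι (suc l))
    m1' = (a + Lι) * (t + ι 2 * K + 1#) * ι (suc l)

    coeff-suc-suc : NonZero (coeffDen a (suc l) (suc j)) → NonZero D0 →
      (coeffNum a (suc l) (suc j) ÷ coeffDen a (suc l) (suc j)) * m1 ≈ (N0 ÷ D0) * m1'
    coeff-suc-suc h1 h0 = ÷-cross h1 h0 (begin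
      coeffNum a (suc l) (suc j) * m1 * D0
        ≈⟨ *-cong (*-cong (*-cong refl (*-cong eL eH)) refl) refl ⟩
      (A * (a + Lι)) * (sg * (- 1#) * (t + ι 2 * (1# + K) - 1#)) * ((- (1# + Lι) * L) * ((t - 1#) * H)) * m1 * D0
        ≈⟨ solve 10 (λ A a Lι K sg L H T J V →
             (A :* (a :+ Lι)) :* (sg :* (:- con (+ 1)) :* (con (+ 2) :* a :+ con (+ 2) :* (con (+ 1) :+ K) :- con (+ 1))) :* ((:- (con (+ 1) :+ Lι) :* L) :* ((con (+ 2) :* a :- con (+ 1)) :* H))
               :* ((con (+ 2) :* a :+ Lι) :* (con (+ 1) :+ K) :* (con (+ 2) :* a :+ (con (+ 1) :+ Lι))) :* (T :* J :* V)
             := (A :* L :* H :* sg) :* ((a :+ Lι) :* (con (+ 2) :* a :+ con (+ 2) :* K :+ con (+ 1)) :* (con (+ 1) :+ Lι))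
               :* ((T :* (con (+ 2) :* a :+ Lι)) :* (con (+ 2) :* a :- con (+ 1)) :* ((J :* (con (+ 1) :+ K)) :* ((con (+ 2) :* a :+ (con (+ 1) :+ Lι)) :* V))))
             refl A a Lι K sg L H T J V ⟩
      N0 * m1' * ((T * (t + Lι)) * (t - 1#) * ((J * (1# + K)) * ((t + ι (suc l)) * V)))
        ≈⟨ *-cong refl (*-cong refl (*-cong refl (sym eV))) ⟩
      N0 * m1' * coeffDen a (suc l) (suc j) ∎)

    t2 = twice (a + 1#)
    A1 = poch (a + 1#) l
    T2 = poch t2 l
    H1 = poch (t2 - 1#) j

    R1 : a * A1 ≈ A * (a + Lι)
    R1 = sym (poch-suc-shift l refl)
    R2 : T * (t + Lι) * (t + ι (suc l)) ≈ t * ((t + 1#) * T2)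
    R2 = begin
      poch t (suc (suc l)) ≈⟨ poch-suc-shift (suc l) refl ⟩
      t * poch (t + 1#) (suc l) ≈⟨ *-cong refl (poch-suc-shift l (solve 1 (λ a → con (+ 2) :* (a :+ con (+ 1)) := (con (+ 2) :* a :+ con (+ 1)) :+ con (+ 1)) refl a)) ⟩
      t * ((t + 1#) * T2) ∎
    R3 : H * (t + K) ≈ t * H1
    R3 = poch-suc-shift j (solve 1 (λ a → con (+ 2) :* (a :+ con (+ 1)) :- con (+ 1) := con (+ 2) :* a :+ con (+ 1)) refl a)

    m2 = a * (t + Lι) * (t + ι (suc l))
    m2' = (a + Lι) * (t + ι 2 * K + 1#) * (t + K)

    coeff-shift : NonZero (coeffDen (a + 1#) l j) → NonZero D0 →
      (coeffNum (a + 1#) l j ÷ coeffDen (a + 1#) l j) * m2 ≈ (N0 ÷ D0) * m2'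
    coeff-shift h2 h0 = ÷-cross h2 h0 (begin
      coeffNum (a + 1#) l j * m2 * D0
        ≈⟨ solve 10 (λ A1 sg a K L H1 Lι T J V →
             A1 :* (sg :* (con (+ 2) :* (a :+ con (+ 1)) :+ con (+ 2) :* K :- con (+ 1))) :* (L :* H1) :* (a :* (con (+ 2) :* a :+ Lι) :* (con (+ 2) :* a :+ (con (+ 1) :+ Lι))) :* (T :* J :* V)
             := (a :* A1) :* (T :* (con (+ 2) :* a :+ Lι) :* (con (+ 2) :* a :+ (con (+ 1) :+ Lι))) :* (sg :* (con (+ 2) :* (a :+ con (+ 1)) :+ con (+ 2) :* K :- con (+ 1)) :* L :* H1 :* J :* V))
             refl A1 sg a K L H1 Lι T J V ⟩
      (a * A1) * (T * (t + Lι) * (t + ι (suc l))) * (sg * (t2 + ι 2 * K - 1#) * L * H1 * J * V)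
        ≈⟨ *-cong (*-cong R1 R2) refl ⟩
      (A * (a + Lι)) * (t * ((t + 1#) * T2)) * (sg * (t2 + ι 2 * K - 1#) * L * H1 * J * V)
        ≈⟨ solve 10 (λ A a Lι T2 sg K L H1 J V →
             (A :* (a :+ Lι)) :* (con (+ 2) :* a :* ((con (+ 2) :* a :+ con (+ 1)) :* T2)) :* (sg :* (con (+ 2) :* (a :+ con (+ 1)) :+ con (+ 2) :* K :- con (+ 1)) :* L :* H1 :* J :* V)
             := (con (+ 2) :* a :* H1) :* (A :* L :* sg :* ((a :+ Lι) :* (con (+ 2) :* a :+ con (+ 2) :* K :+ con (+ 1))) :* T2 :* (con (+ 2) :* (a :+ con (+ 1)) :- con (+ 1)) :* J :* V))
             refl A a Lι T2 sg K L H1 J V ⟩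
      (t * H1) * (A * L * sg * ((a + Lι) * (t + ι 2 * K + 1#)) * T2 * (t2 - 1#) * J * V)
        ≈⟨ *-cong (sym R3) refl ⟩
      (H * (t + K)) * (A * L * sg * ((a + Lι) * (t + ι 2 * K + 1#)) * T2 * (t2 - 1#) * J * V)
        ≈⟨ solve 10 (λ H a K A L sg Lι T2 J V →
             (H :* (con (+ 2) :* a :+ K)) :* (A :* L :* sg :* ((a :+ Lι) :* (con (+ 2) :* a :+ con (+ 2) :* K :+ con (+ 1))) :* T2 :* (con (+ 2) :* (a :+ con (+ 1)) :- con (+ 1)) :* J :* V)
             := (A :* L :* H :* sg) :* ((a :+ Lι) :* (con (+ 2) :* a :+ con (+ 2) :* K :+ con (+ 1)) :* (con (+ 2) :* a :+ K)) :* (T2 :* (con (+ 2) :* (a :+ con (+ 1)) :- con (+ 1)) :* (J :* V)))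
             refl H a K A L sg Lι T2 J V ⟩
      N0 * m2' * coeffDen (a + 1#) l j ∎)

    Y1 = poch (t + ι (suc l)) j
    W = poch (t + ι l) (suc j)
    eW : W ≈ (t + Lι) * Y1
    eW = poch-suc-shift j (solve 2 (λ t x → t :+ (con (+ 1) :+ x) := (t :+ x) :+ con (+ 1)) refl t (ι l))

    m3 = (1# + K) * (t + Lι) * (t + ι (suc l))
    m3' = - (t + ι 2 * K + 1#) * (K - Lι) * (t + ι (suc l) + K)

    coeff-suc : NonZero (coeffDen a l (suc j)) → NonZero D0 →
      (coeffNum a l (suc j) ÷ coeffDen a l (suc j)) * m3 ≈ (N0 ÷ D0) * m3'
    coeff-suc h3 h0 = ÷-cross h3 h0 (begin
      coeffNum a l (suc j) * m3 * D0
        ≈⟨ *-cong (*-cong (*-cong refl (*-cong refl eH)) refl) refl ⟩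
      A * (sg * (- 1#) * (t + ι 2 * (1# + K) - 1#)) * (L * (- Lι + K) * ((t - 1#) * H)) * m3 * D0
        ≈⟨ solve 10 (λ A sg a K L Lι H T J V →
             A :* (sg :* (:- con (+ 1)) :* (con (+ 2) :* a :+ con (+ 2) :* (con (+ 1) :+ K) :- con (+ 1))) :* (L :* (:- Lι :+ K) :* ((con (+ 2) :* a :- con (+ 1)) :* H))
               :* ((con (+ 1) :+ K) :* (con (+ 2) :* a :+ Lι) :* (con (+ 2) :* a :+ (con (+ 1) :+ Lι))) :* (T :* J :* V)
             := ((con (+ 2) :* a :+ (con (+ 1) :+ Lι)) :* V) :* (A :* L :* H :* sg :* (:- (con (+ 2) :* a :+ con (+ 2) :* K :+ con (+ 1)) :* (K :- Lι)) :* T :* (con (+ 2) :* a :- con (+ 1)) :* J :* (con (+ 1) :+ K) :* (con (+ 2) :* a :+ Lι)))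
             refl A sg a K L Lι H T J V ⟩
      ((t + ι (suc l)) * V) * (A * L * H * sg * (- (t + ι 2 * K + 1#) * (K - Lι)) * T * (t - 1#) * J * (1# + K) * (t + Lι))
        ≈⟨ *-cong (sym eV) refl ⟩
      (Y1 * (t + ι (suc l) + K)) * (A * L * H * sg * (- (t + ι 2 * K + 1#) * (K - Lι)) * T * (t - 1#) * J * (1# + K) * (t + Lι))
        ≈⟨ solve 10 (λ Y1 a Lι K A L H sg T J →
             (Y1 :* (con (+ 2) :* a :+ (con (+ 1) :+ Lι) :+ K)) :* (A :* L :* H :* sg :* (:- (con (+ 2) :* a :+ con (+ 2) :* K :+ con (+ 1)) :* (K :- Lι)) :* T :* (con (+ 2) :* a :- con (+ 1)) :* J :* (con (+ 1) :+ K) :* (con (+ 2) :* a :+ Lι))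
             := (A :* L :* H :* sg) :* (:- (con (+ 2) :* a :+ con (+ 2) :* K :+ con (+ 1)) :* (K :- Lι) :* (con (+ 2) :* a :+ (con (+ 1) :+ Lι) :+ K)) :* (T :* (con (+ 2) :* a :- con (+ 1)) :* ((J :* (con (+ 1) :+ K)) :* ((con (+ 2) :* a :+ Lι) :* Y1))))
             refl Y1 a Lι K A L H sg T J ⟩
      N0 * m3' * (T * (t - 1#) * ((J * (1# + K)) * ((t + Lι) * Y1)))
        ≈⟨ *-cong refl (*-cong refl (*-cong refl (sym eW))) ⟩
      N0 * m3' * coeffDen a l (suc j) ∎)

    M = a * (1# + K) * (t + Lι) * (t + ι (suc l))

    recurrence-from-normal-forms : ∀ C1 C2 C3 → NonZero M →
      C1 * m1 ≈ (N0 ÷ D0) * m1' → C2 * m2 ≈ (N0 ÷ D0) * m2' → C3 * m3 ≈ (N0 ÷ D0) * m3' →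
      (t + Lι) * C1 ≈ a * C2 + (Lι + a) * C3
    recurrence-from-normal-forms C1 C2 C3 hM e1 e2 e3 = *-cancelʳ hM (begin
      ((t + Lι) * C1) * M
        ≈⟨ solve 4 (λ C1 a Lι K → ((con (+ 2) :* a :+ Lι) :* C1) :* (a :* (con (+ 1) :+ K) :* (con (+ 2) :* a :+ Lι) :* (con (+ 2) :* a :+ (con (+ 1) :+ Lι)))
              := (a :* (con (+ 2) :* a :+ Lι)) :* (C1 :* ((con (+ 2) :* a :+ Lι) :* (con (+ 1) :+ K) :* (con (+ 2) :* a :+ (con (+ 1) :+ Lι))))) refl C1 a Lι K ⟩
      (a * (t + Lι)) * (C1 * m1) ≈⟨ *-cong refl e1 ⟩
      (a * (t + Lι)) * (Q * m1')
        ≈⟨ solve 4 (λ Q a Lι K →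
             (a :* (con (+ 2) :* a :+ Lι)) :* (Q :* ((a :+ Lι) :* (con (+ 2) :* a :+ con (+ 2) :* K :+ con (+ 1)) :* (con (+ 1) :+ Lι)))
             := ((con (+ 1) :+ K) :* a) :* (Q :* ((a :+ Lι) :* (con (+ 2) :* a :+ con (+ 2) :* K :+ con (+ 1)) :* (con (+ 2) :* a :+ K)))
                :+ ((Lι :+ a) :* a) :* (Q :* (:- (con (+ 2) :* a :+ con (+ 2) :* K :+ con (+ 1)) :* (K :- Lι) :* (con (+ 2) :* a :+ (con (+ 1) :+ Lι) :+ K))))
             refl Q a Lι K ⟩
      ((1# + K) * a) * (Q * m2') + ((Lι + a) * a) * (Q * m3') ≈⟨ sym (+-cong (*-cong refl e2) (*-cong refl e3)) ⟩
      ((1# + K) * a) * (C2 * m2) + ((Lι + a) * a) * (C3 * m3)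
        ≈⟨ solve 5 (λ C2 C3 a Lι K → ((con (+ 1) :+ K) :* a) :* (C2 :* (a :* (con (+ 2) :* a :+ Lι) :* (con (+ 2) :* a :+ (con (+ 1) :+ Lι))))
                 :+ ((Lι :+ a) :* a) :* (C3 :* ((con (+ 1) :+ K) :* (con (+ 2) :* a :+ Lι) :* (con (+ 2) :* a :+ (con (+ 1) :+ Lι))))
              := (a :* C2 :+ (Lι :+ a) :* C3) :* (a :* (con (+ 1) :+ K) :* (con (+ 2) :* a :+ Lι) :* (con (+ 2) :* a :+ (con (+ 1) :+ Lι)))) refl C2 C3 a Lι K ⟩
      (a * C2 + (Lι + a) * C3) * M ∎)
      where
      Q = N0 ÷ D0

  2*l≡l+l : ∀ l → 2 N.* l ≡ l N.+ l
  2*l≡l+l l = P.cong (l N.+_) (NP.+-identityʳ l)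

  Admissible-below : ∀ {a l m} → Admissible a l → m ≤ 2 N.* l → ∀ j → j < m → NonZero (twice a + ι j)
  Admissible-below (_ , h) m≤ j j< = h j (NP.≤-trans j< m≤)

  Admissible-pred : ∀ {a l} → Admissible a (suc l) → Admissible a l
  Admissible-pred {a} {l} (h₁ , h₂) = h₁ , (λ j j< → h₂ j (NP.≤-trans j< (NP.*-monoʳ-≤ 2 (NP.n≤1+n l))))

  Admissible-shift : ∀ {a l} → Admissible a (suc l) → Admissible (a + 1#) l
  Admissible-shift {a} {l} (h₁ , h₂) =
    NonZero-resp (sym twice-suc-1) (h₂ 1 (NP.*-monoʳ-≤ 2 (s≤s (z≤n {l})))) ,
    (λ j j< → NonZero-resp (sym (twice-suc-+ j)) (h₂ (2 N.+ j) (2+j<2[1+l] j j<)))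
    where
    twice-suc-1 : twice (a + 1#) - 1# ≈ twice a + ι 1
    twice-suc-1 = solve 1 (λ a → con (+ 2) :* (a :+ con (+ 1)) :- con (+ 1) := con (+ 2) :* a :+ (con (+ 1) :+ con (+ 0))) refl a
    twice-suc-+ : ∀ j → twice (a + 1#) + ι j ≈ twice a + ι (2 N.+ j)
    twice-suc-+ j = solve 2 (λ a x → con (+ 2) :* (a :+ con (+ 1)) :+ x := con (+ 2) :* a :+ (con (+ 1) :+ (con (+ 1) :+ x))) refl a (ι j)
    2+j<2[1+l] : ∀ j → j < 2 N.* l → 2 N.+ j < 2 N.* suc l
    2+j<2[1+l] j j< = P.subst (2 N.+ j <_) (P.sym (NP.*-distribˡ-+ 2 1 l)) (NP.+-monoʳ-< 2 j<)

  Admissible⇒nonZero : ∀ {a l} → Admissible a (suc l) → NonZero a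
  Admissible⇒nonZero {a} (_ , h) a≈0 = h 0 (s≤s z≤n) (trans (+-cong (*-cong refl a≈0) refl) (trans (+-identityʳ _) (zeroʳ _)))

  coeff-recurrence : ∀ a l j → Admissible a (suc l) → j ≤ l →
    (twice a + ι l) * coeff a (suc l) (suc j) ≈ a * coeff (a + 1#) l j + (ι l + a) * coeff a l (suc j)
  coeff-recurrence a l j adm@(h₁ , h₂) j≤l =
    recurrence-from-normal-forms _ _ _ M≉0
      (trans (*-cong (coeff≈num÷den a (suc l) (suc j) h₁ hA) refl)
             (coeff-suc-suc (coeffDen-nonZero a (suc l) (suc j) h₁ hA) D0≉0))
      (trans (*-cong (coeff≈num÷den (a + 1#) l j (proj₁ adm') hB) refl)
             (coeff-shift (coeffDen-nonZero (a + 1#) l j (proj₁ adm') hB) D0≉0))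
      (trans (*-cong (coeff≈num÷den a l (suc j) h₁ hC) refl)
             (coeff-suc (coeffDen-nonZero a l (suc j) h₁ hC) D0≉0))
    where
    open CoeffRecurrence a l j
    adm' = Admissible-shift adm
    2[1+l] : 2 N.* suc l ≡ suc l N.+ suc l
    2[1+l] = 2*l≡l+l (suc l)
    hA : ∀ j' → j' < suc l N.+ suc j → NonZero (twice a + ι j')
    hA = Admissible-below {a} {suc l} adm (P.subst (suc l N.+ suc j ≤_) (P.sym 2[1+l]) (NP.+-monoʳ-≤ (suc l) (s≤s j≤l)))
    hB : ∀ j' → j' < l N.+ j → NonZero (twice (a + 1#) + ι j')
    hB = Admissible-below {a + 1#} {l} adm' (P.subst (l N.+ j ≤_) (P.sym (2*l≡l+l l)) (NP.+-monoʳ-≤ l j≤l))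
    hC : ∀ j' → j' < l N.+ suc j → NonZero (twice a + ι j')
    hC = Admissible-below {a} {suc l} adm (P.subst (l N.+ suc j ≤_) (P.sym 2[1+l]) (NP.+-mono-≤ (NP.n≤1+n l) (s≤s j≤l)))
    D0≉0 : NonZero D0
    D0≉0 = *-nonZero (*-nonZero (poch-nonZero l (λ j' j'< → h₂ j' (NP.≤-trans j'< (NP.≤-trans (NP.n≤1+n l) (NP.m≤n*m (suc l) 2)))))
                                (fact-nonZero j))
                     (poch-nonZero j (λ j' j'< → +ι-+-nonZero l j' (proj₂ adm' (l N.+ j') (l+j'<2l j' j'<))))
      where
      l+j'<2l : ∀ j' → j' < j → l N.+ j' < 2 N.* l
      l+j'<2l j' j'< = P.subst (l N.+ j' <_) (P.sym (2*l≡l+l l)) (NP.+-monoʳ-< l (NP.≤-trans j'< j≤l))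
    M≉0 : NonZero M
    M≉0 = *-nonZero (*-nonZero (*-nonZero (Admissible⇒nonZero adm) (char0 j)) (h₂ l (NP.m≤n*m (suc l) 2)))
                    (h₂ (suc l) (P.subst (suc l <_) (NP.*-comm (suc l) 2) (NP.m<m*n (suc l) 2 (s≤s (s≤s z≤n)))))

  coeff-zero : ∀ a l → NonZero (twice a - 1#) → coeff a l 0 ≈ poch a l ÷ poch (twice a) l
  coeff-zero a l h = begin
    (poch a l ÷ poch (twice a) l) * (1# * ((twice a + ι 2 * 0# - 1#) ÷ (twice a - 1#)) * ((1# * 1#) ÷ (1# * 1#)))
      ≈⟨ *-cong refl (*-cong (*-cong refl unit-ratio) 1*1÷1*1≈1) ⟩
    (poch a l ÷ poch (twice a) l) * (1# * 1# * 1#)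
      ≈⟨ trans (*-cong refl (trans (*-identityʳ _) (*-identityʳ _))) (*-identityʳ _) ⟩
    poch a l ÷ poch (twice a) l ∎
    where
    unit-ratio : (twice a + ι 2 * 0# - 1#) ÷ (twice a - 1#) ≈ 1#
    unit-ratio = trans (*-cong (+-cong (trans (+-cong refl (zeroʳ _)) (+-identityʳ _)) refl) refl) (⁻¹-inverseʳ h)
    1*1÷1*1≈1 : (1# * 1#) ÷ (1# * 1#) ≈ 1#
    1*1÷1*1≈1 = trans (*-cong (*-identityˡ 1#) (⁻¹-cong (NonZero-resp (sym (*-identityˡ 1#)) 1-nonZero) (*-identityˡ 1#)))
                      (trans (*-identityˡ _) 1⁻¹≈1)

  coeff-recurrence-zero : ∀ a l → Admissible a (suc l) → (twice a + ι l) * coeff a (suc l) 0 ≈ (ι l + a) * coeff a l 0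
  coeff-recurrence-zero a l (h₁ , h₂) = begin
    u * coeff a (suc l) 0
      ≈⟨ *-cong refl (coeff-zero a (suc l) h₁) ⟩
    u * ((poch a l * (a + ι l)) * (poch (twice a) l * u) ⁻¹)
      ≈⟨ *-cong refl (*-cong refl (⁻¹-distrib-* T≉0 u≉0)) ⟩
    u * ((poch a l * (a + ι l)) * (poch (twice a) l ⁻¹ * u ⁻¹))
      ≈⟨ solve 5 (λ u A x Ti ui → u :* ((A :* x) :* (Ti :* ui)) := (x :* (A :* Ti)) :* (u :* ui))
           refl u (poch a l) (a + ι l) (poch (twice a) l ⁻¹) (u ⁻¹) ⟩
    ((a + ι l) * (poch a l ÷ poch (twice a) l)) * (u * u ⁻¹)
      ≈⟨ *-cong (*-cong (+-comm _ _) (sym (coeff-zero a l h₁))) (⁻¹-inverseʳ u≉0) ⟩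
    ((ι l + a) * coeff a l 0) * 1#
      ≈⟨ *-identityʳ _ ⟩
    (ι l + a) * coeff a l 0 ∎
    where
    u = twice a + ι l
    T≉0 : NonZero (poch (twice a) l)
    T≉0 = poch-nonZero l (λ j j< → h₂ j (NP.≤-trans j< (NP.≤-trans (NP.n≤1+n l) (NP.m≤n*m (suc l) 2))))
    u≉0 : NonZero u
    u≉0 = h₂ l (NP.m≤n*m (suc l) 2)

  coeff-top : ∀ a l → coeff a l (suc l) ≈ 0#
  coeff-top a l = begin
    br1/1 a (twice a) l * (sgn (suc l) * q * ((poch (- ι l) (suc l) * poch (twice a - 1#) (suc l)) * Di))
      ≈⟨ *-cong refl (*-cong refl (*-cong (*-cong (poch-top≈0 l) refl) refl)) ⟩
    br1/1 a (twice a) l * (sgn (suc l) * q * ((0# * poch (twice a - 1#) (suc l)) * Di))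
      ≈⟨ solve 5 (λ b s q r d → b :* (s :* q :* ((con (+ 0) :* r) :* d)) := con (+ 0)) refl _ _ _ _ _ ⟩
    0# ∎
    where
    q = (twice a + ι 2 * ι (suc l) - 1#) ÷ (twice a - 1#)
    Di = (poch 1# (suc l) * poch (twice a + ι l) (suc l)) ⁻¹
  Φ-cong : ∀ n l {a a'} → a ≈ a' → Φ n l a ≈ Φ n l a'
  Φ-cong n l e = sumTo-cong n (λ k _ →
    *-cong (*-cong (*-cong (*-cong (poch-cong k e) (poch-cong k (+-cong refl (-‿cong e)))) refl) refl) refl)

  contiguity-term : ∀ l a k →
    (twice a + ι l) * (poch a k * poch (1# - ι (suc l) - a) k)
      ≈ a * (poch (a + 1#) k * poch (1# - ι l - (a + 1#)) k) + (ι l + a) * (poch a k * poch (1# - ι l - a) k)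
  contiguity-term l a k = begin
    (twice a + ι l) * (Pa * poch (1# - ι (suc l) - a) k)
      ≈⟨ *-cong refl (*-cong refl e1) ⟩
    (twice a + ι l) * (Pa * Pm)
      ≈⟨ solve 5 (λ a L K Pa Pm → (con (+ 2) :* a :+ L) :* (Pa :* Pm) := (Pa :* (a :+ K)) :* Pm :- Pa :* (Pm :* (:- L :- a :+ K)))
           refl a (ι l) (ι k) Pa Pm ⟩
    (Pa * (a + ι k)) * Pm - Pa * (Pm * (- ι l - a + ι k))
      ≈⟨ +-cong (*-cong (sym r1) refl) (-‿cong (*-cong refl (sym r2))) ⟩
    (a * Pa1) * Pm - Pa * ((- ι l - a) * Pb)
      ≈⟨ solve 6 (λ a L Pa1 Pm Pa Pb → (a :* Pa1) :* Pm :- Pa :* ((:- L :- a) :* Pb) := a :* (Pa1 :* Pm) :+ (L :+ a) :* (Pa :* Pb))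
           refl a (ι l) Pa1 Pm Pa Pb ⟩
    a * (Pa1 * Pm) + (ι l + a) * (Pa * Pb)
      ≈⟨ +-cong (*-cong refl (*-cong refl (sym e2))) refl ⟩
    a * (Pa1 * poch (1# - ι l - (a + 1#)) k) + (ι l + a) * (Pa * Pb) ∎
    where
    Pa = poch a k
    Pa1 = poch (a + 1#) k
    Pm = poch (- ι l - a) k
    Pb = poch (1# - ι l - a) k
    e1 : poch (1# - ι (suc l) - a) k ≈ Pm
    e1 = poch-cong k (solve 2 (λ L a → con (+ 1) :- (con (+ 1) :+ L) :- a := :- L :- a) refl (ι l) a)
    e2 : poch (1# - ι l - (a + 1#)) k ≈ Pm
    e2 = poch-cong k (solve 2 (λ L a → con (+ 1) :- L :- (a :+ con (+ 1)) := :- L :- a) refl (ι l) a)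
    r1 : a * Pa1 ≈ Pa * (a + ι k)
    r1 = sym (poch-suc-shift k refl)
    r2 : (- ι l - a) * Pb ≈ Pm * (- ι l - a + ι k)
    r2 = sym (poch-suc-shift k (solve 2 (λ L a → con (+ 1) :- L :- a := (:- L :- a) :+ con (+ 1)) refl (ι l) a))

  contiguity : ∀ n l a → (twice a + ι l) * Φ n (suc l) a ≈ a * Φ n l (a + 1#) + (ι l + a) * Φ n l a
  contiguity n l a = begin
    u * Φ n (suc l) a
      ≈⟨ *-distribˡ-sumTo n _ _ ⟩
    sumTo n (λ k → u * term (suc l) a k)
      ≈⟨ sumTo-cong n (λ k _ → termwise k) ⟩
    sumTo n (λ k → a * term l (a + 1#) k + (ι l + a) * term l a k)
      ≈⟨ sumTo-+ n _ _ ⟩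
    sumTo n (λ k → a * term l (a + 1#) k) + sumTo n (λ k → (ι l + a) * term l a k)
      ≈⟨ sym (+-cong (*-distribˡ-sumTo n _ _) (*-distribˡ-sumTo n _ _)) ⟩
    a * Φ n l (a + 1#) + (ι l + a) * Φ n l a ∎
    where
    u = twice a + ι l
    term : ℕ → Carrier → ℕ → Carrier
    term l' b k = ((poch b k * poch (1# - ι l' - b) k * poch (- ι n) k) ÷ (fact k * poch half k * poch (eParam n) k)) * pow ¾ k
    termwise : ∀ k → u * term (suc l) a k ≈ a * term l (a + 1#) k + (ι l + a) * term l a k
    termwise k = begin
      u * term (suc l) a k
        ≈⟨ *-cong refl (F32-term-split _ _ _ _ _) ⟩
      u * ((poch a k * poch (1# - ι (suc l) - a) k) * weight n k)
        ≈⟨ sym (*-assoc _ _ _) ⟩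
      (u * (poch a k * poch (1# - ι (suc l) - a) k)) * weight n k
        ≈⟨ *-cong (contiguity-term l a k) refl ⟩
      (a * P2 + (ι l + a) * P3) * weight n k
        ≈⟨ solve 5 (λ a P2 u P3 C → (a :* P2 :+ u :* P3) :* C := a :* (P2 :* C) :+ u :* (P3 :* C)) refl a P2 (ι l + a) P3 (weight n k) ⟩
      a * (P2 * weight n k) + (ι l + a) * (P3 * weight n k)
        ≈⟨ sym (+-cong (*-cong refl (F32-term-split _ _ _ _ _)) (*-cong refl (F32-term-split _ _ _ _ _))) ⟩
      a * term l (a + 1#) k + (ι l + a) * term l a k ∎
      where
      P2 = poch (a + 1#) k * poch (1# - ι l - (a + 1#)) k
      P3 = poch a k * poch (1# - ι l - a) k

  Φ-expansion : ∀ n l a → Admissible a l → Φ n l a ≈ sumTo l (λ i → coeff a l i * Φ n 0 (a + ι i))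
  Φ-expansion n zero a (h₁ , _) = begin
    Φ n 0 a                        ≈⟨ sym (*-identityˡ _) ⟩
    1# * Φ n 0 a                   ≈⟨ *-cong (sym (trans (coeff-zero a 0 h₁) (trans (*-identityˡ _) 1⁻¹≈1)))
                                             (Φ-cong n 0 (sym (+-identityʳ a))) ⟩
    coeff a 0 0 * Φ n 0 (a + ι 0)  ∎
  Φ-expansion n (suc l) a adm@(_ , h₂) = *-cancelʳ u≉0 (begin
    Φ n (suc l) a * u
      ≈⟨ *-comm _ _ ⟩
    u * Φ n (suc l) a
      ≈⟨ contiguity n l a ⟩
    a * Φ n l (a + 1#) + (ι l + a) * Φ n l a
      ≈⟨ +-cong (*-cong refl (trans (Φ-expansion n l (a + 1#) (Admissible-shift adm)) (sumTo-cong l (λ i _ → shift i))))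
                (*-cong refl (Φ-expansion n l a (Admissible-pred adm))) ⟩
    a * sumTo l (λ i → coeff (a + 1#) l i * Φ₀ (suc i)) + (ι l + a) * sumTo l (G l)
      ≈⟨ +-cong (*-distribˡ-sumTo l _ _) (*-distribˡ-sumTo l _ _) ⟩
    sumTo l (λ i → a * (coeff (a + 1#) l i * Φ₀ (suc i))) + sumTo l (λ i → (ι l + a) * G l i)
      ≈⟨ sumTo-+-shifted l _ _ (λ i → u * G (suc l) i) top≈0 term₀ termᵢ ⟩
    sumTo (suc l) (λ i → u * G (suc l) i)
      ≈⟨ sym (*-distribˡ-sumTo (suc l) u (G (suc l))) ⟩
    u * sumTo (suc l) (G (suc l))
      ≈⟨ *-comm _ _ ⟩
    sumTo (suc l) (G (suc l)) * u ∎)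
    where
    u = twice a + ι l
    u≉0 : NonZero u
    u≉0 = h₂ l (NP.m≤n*m (suc l) 2)
    Φ₀ : ℕ → Carrier
    Φ₀ i = Φ n 0 (a + ι i)
    G : ℕ → ℕ → Carrier
    G l' i = coeff a l' i * Φ₀ i
    shift : ∀ i → coeff (a + 1#) l i * Φ n 0 ((a + 1#) + ι i) ≈ coeff (a + 1#) l i * Φ₀ (suc i)
    shift i = *-cong refl (Φ-cong n 0 (solve 2 (λ a x → (a :+ con (+ 1)) :+ x := a :+ (con (+ 1) :+ x)) refl a (ι i)))
    top≈0 : (ι l + a) * G l (suc l) ≈ 0#
    top≈0 = trans (*-cong refl (trans (*-cong (coeff-top a l) refl) (zeroˡ _))) (zeroʳ _)
    term₀ : (ι l + a) * G l 0 ≈ u * G (suc l) 0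
    term₀ = trans (sym (*-assoc _ _ _)) (trans (*-cong (sym (coeff-recurrence-zero a l adm)) refl) (*-assoc _ _ _))
    termᵢ : ∀ i → i ≤ l → a * (coeff (a + 1#) l i * Φ₀ (suc i)) + (ι l + a) * G l (suc i) ≈ u * G (suc l) (suc i)
    termᵢ i i≤ = begin
      a * (coeff (a + 1#) l i * Φ₀ (suc i)) + (ι l + a) * (coeff a l (suc i) * Φ₀ (suc i))
        ≈⟨ solve 5 (λ a x v y f → a :* (x :* f) :+ v :* (y :* f) := (a :* x :+ v :* y) :* f)
             refl a (coeff (a + 1#) l i) (ι l + a) (coeff a l (suc i)) (Φ₀ (suc i)) ⟩
      (a * coeff (a + 1#) l i + (ι l + a) * coeff a l (suc i)) * Φ₀ (suc i)
        ≈⟨ *-cong (sym (coeff-recurrence a l i adm i≤)) refl ⟩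
      (u * coeff a (suc l) (suc i)) * Φ₀ (suc i)
        ≈⟨ *-assoc _ _ _ ⟩
      u * G (suc l) (suc i) ∎

module AtThreeX {c ℓ} (F : Field0 c ℓ) (x : Field0.Carrier F) where
  open Expansion F public

  twice-3x≈6x : twice (ι 3 * x) ≈ ι 6 * x
  twice-3x≈6x = solve 1 (λ x → con (+ 2) :* (con (+ 3) :* x) := con (+ 6) :* x) refl x

  Admissible-3x : ∀ l → NonZero (ι 6 * x - 1#) → (∀ j → j < 2 N.* l → NonZero (ι 6 * x + ι j)) →
    Admissible (ι 3 * x) l
  Admissible-3x l 6x-1≉0 6x+j≉0 =
    NonZero-resp (+-cong (sym twice-3x≈6x) refl) 6x-1≉0 ,
    (λ j j< → NonZero-resp (+-cong (sym twice-3x≈6x) refl) (6x+j≉0 j j<))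

  coeff-3x : ∀ l i → Admissible (ι 3 * x) l → i ≤ l →
    coeff (ι 3 * x) l i
      ≈ br1/1 (ι 3 * x) (ι 6 * x) l
        * (sgn i * ((ι 6 * x + ι 2 * ι i - 1#) ÷ (ι 6 * x - 1#)) * br2/2 (- ι l) (ι 6 * x - 1#) 1# (ι 6 * x + ι l) i)
  coeff-3x l i (h₁ , h₂) i≤l =
    *-cong (÷-cong poch-2a≉0 refl (poch-cong l e))
           (*-cong (*-cong refl (÷-cong h₁ (+-cong (+-cong e refl) refl) (+-cong e refl)))
                   (÷-cong lower≉0 (*-cong refl (poch-cong i (+-cong e refl))) (*-cong refl (poch-cong i (+-cong e refl)))))
    where
    e = twice-3x≈6x
    l+l≡2l = P.sym (2*l≡l+l l)
    poch-2a≉0 : NonZero (poch (twice (ι 3 * x)) l)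
    poch-2a≉0 = poch-nonZero l (λ j j< → h₂ j (P.subst (j <_) l+l≡2l (NP.≤-trans j< (NP.m≤m+n l l))))
    lower≉0 : NonZero (fact i * poch (twice (ι 3 * x) + ι l) i)
    lower≉0 = *-nonZero (fact-nonZero i) (poch-nonZero i (λ j j< →
                +ι-+-nonZero l j (h₂ (l N.+ j) (P.subst (l N.+ j <_) l+l≡2l (NP.+-monoʳ-< l (NP.≤-trans j< i≤l))))))

  Φ₀-3x+i : ∀ n i → Φ n 0 (ι 3 * x + ι i)
    ≈ (ι 3 * x + ι i) * br2/2 ((ι 3 + ι i) ÷ ι 3 + x) ((ι 3 - ι i) ÷ ι 3 - x) (ι 2 ÷ ι 3) (ι 4 ÷ ι 3) n
      - (ι 3 * x + ι i - 1#) * br2/2 ((ι 2 + ι i) ÷ ι 3 + x) ((ι 4 - ι i) ÷ ι 3 - x) (ι 2 ÷ ι 3) (ι 4 ÷ ι 3) n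
  Φ₀-3x+i n i = Φ₀-closed-form n (ι 3 * x + ι i) (plus (ι 3)) (minus (ι 3)) (plus (ι 2)) (minus (ι 4))
    where
    plus : ∀ c → ι 3 * ((c + ι i) ÷ ι 3 + x) ≈ c + (ι 3 * x + ι i)
    plus c = trans (distribˡ _ _ _)
                   (trans (+-cong (3*[c÷3]≈c (c + ι i)) refl)
                          (solve 3 (λ c u y → (c :+ u) :+ y := c :+ (y :+ u)) refl c (ι i) (ι 3 * x)))
    minus : ∀ c → ι 3 * ((c - ι i) ÷ ι 3 - x) ≈ c - (ι 3 * x + ι i)
    minus c = trans (solve 2 (λ d y → con (+ 3) :* (d :- y) := con (+ 3) :* d :- con (+ 3) :* y) refl ((c - ι i) ÷ ι 3) x)
                    (trans (+-cong (3*[c÷3]≈c (c - ι i)) refl)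
                           (solve 3 (λ c u x → (c :- u) :- con (+ 3) :* x := c :- (con (+ 3) :* x :+ u)) refl c (ι i) x))

proposition17 : ∀ {c ℓ} (F : Field0 c ℓ) → let open Field0 F in
    (l n : ℕ) (x : Carrier) →
    ¬ (ι 6 * x - 1# ≈ 0#) →
    (∀ j → j < 2 Data.Nat.* l → ¬ (ι 6 * x + ι j ≈ 0#)) →
    F32 (ι 3 * x) (1# - ι l - ι 3 * x) n (1# ÷ ι 2) (- ι (1 Data.Nat.+ 3 Data.Nat.* n)) (ι 3 ÷ ι 4)
      ≈ br1/1 (ι 3 * x) (ι 6 * x) l
        * sumTo l (λ i →
            sgn i * ((ι 6 * x + ι 2 * ι i - 1#) ÷ (ι 6 * x - 1#))
            * br2/2 (- ι l) (ι 6 * x - 1#) 1# (ι 6 * x + ι l) i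
            * ((ι 3 * x + ι i)
                 * br2/2 ((ι 3 + ι i) ÷ ι 3 + x) ((ι 3 - ι i) ÷ ι 3 - x) (ι 2 ÷ ι 3) (ι 4 ÷ ι 3) n
               - (ι 3 * x + ι i - 1#)
                 * br2/2 ((ι 2 + ι i) ÷ ι 3 + x) ((ι 4 - ι i) ÷ ι 3 - x) (ι 2 ÷ ι 3) (ι 4 ÷ ι 3) n))
proposition17 F l n x 6x-1≉0 6x+j≉0 = begin
  Φ n l (ι 3 * x)                                                ≈⟨ Φ-expansion n l (ι 3 * x) adm ⟩
  sumTo l (λ i → coeff (ι 3 * x) l i * Φ n 0 (ι 3 * x + ι i))    ≈⟨ sumTo-cong l (λ i i≤l → *-cong (coeff-3x l i adm i≤l) (Φ₀-3x+i n i)) ⟩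
  sumTo l (λ i → (br1/1 (ι 3 * x) (ι 6 * x) l * _) * _)          ≈⟨ sumTo-factorˡ l _ _ _ ⟩
  _                                                              ∎
  where
  open AtThreeX F x
  adm = Admissible-3x l 6x-1≉0 6x+j≉0
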